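{- Let $n>1$ and consider labeled chip-firing on the infinite rooted directed binary ($k=2$) tree starting with chips $1,\dots,2^n$ at the root. Then the smallest spread of a chip is $1$, attained by chips $1$ and $2^n$; the second smallest spread is $2^{n-1}$, attained by chips $2$, $3$, $2^n-2$ and $2^n-1$; and the largest spread is $2^n-2$, attained by chips $2^{n-1}$ and $2^{n-1}+1$.
   Context: The infinite rooted directed $k$-ary tree: every vertex has $k$ children ordered from leftmost to rightmost; the root is on layer 1 and children of a vertex on layer $\ell$ are on layer $\ell+1$. Labeled chip-firing: initially chips labeled $1,\dots,k^n$ are on the root; a vertex holding at least $k$ chips may fire by choosing any $k$ of its chips and sending the chip with the $r$-th smallest label to its $r$-th leftmost child ($r=1,\dots,k$); the game ends when no vertex can fire (stable configuration), and in every stable configuration each of the $k^n$ vertices of layer $n+1$ holds exactly one chip. Number the vertices of layer $n+1$ from $1$ to $k^n$ from left to right. A chip can land at a vertex of layer $n+1$ if some firing strategy produces a stable configuration with that chip on that vertex. The spread of a chip $c$ is (index of the rightmost vertex of layer $n+1$ at which $c$ can land) $-$ (index of the leftmost such vertex) $+1$. -}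

module Defs where

open import Data.Nat using (ℕ; zero; suc; _+_; _*_; _∸_; _^_; _≤_; _<_)
open import Data.Fin using (Fin; toℕ)
open import Data.Bool using (Bool; true; false)
open import Data.List using (List; []; _∷_; _++_; [_]; length; foldl)
open import Data.Product using (Σ; ∃; _×_; _,_)
open import Relation.Binary.PropositionalEquality using (_≡_; _≢_)
open import Relation.Binary.Construct.Closure.ReflexiveTransitive using (Star)

-- A vertex is the path from the root:
-- a list of directions, false = left child, true = right child.
-- The root is [] (layer 1); a vertex given by a path of length ℓ-1 is on layer ℓ.
Vertex : Set
Vertex = List Bool

Chip : ℕ → Set
Chip n = Fin (2 ^ n)

label : (n : ℕ) → Chip n → ℕ
label n c = suc (toℕ c)

Config : ℕ → Set
Config n = Chip n → Vertex

initial : (n : ℕ) → Config n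
initial n _ = []

data Fires {n : ℕ} (c c′ : Config n) : Set where
  fire : (v : Vertex) (a b : Chip n) →
         toℕ a < toℕ b →
         c a ≡ v → c b ≡ v →
         c′ a ≡ v ++ [ false ] →
         c′ b ≡ v ++ [ true ] →
         (∀ x → x ≢ a → x ≢ b → c′ x ≡ c x) →
         Fires c c′

Reachable : (n : ℕ) → Config n → Set
Reachable n c = Star (Fires {n}) (initial n) c

-- Stable: no vertex holds two (or more) chips, i.e. no vertex can fire.
Stable : {n : ℕ} → Config n → Set
Stable {n} c = (a b : Chip n) → c a ≡ c b → a ≡ b

-- Left-to-right number (1-based) of a vertex within its layer:
-- the path read as a binary number (most significant digit first), plus 1.
bit : Bool → ℕ
bit false = 0
bit true  = 1

index : Vertex → ℕ
index p = suc (foldl (λ acc d → 2 * acc + bit d) 0 p)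

CanLand : (n : ℕ) → Chip n → ℕ → Set
CanLand n ch i =
  Σ (Config n) λ c → Reachable n c × Stable {n} c ×
    length (c ch) ≡ n × index (c ch) ≡ i

Spread : (n : ℕ) → Chip n → ℕ → Set
Spread n ch s =
  Σ ℕ λ lo → Σ ℕ λ hi →
    CanLand n ch lo × CanLand n ch hi ×
    (∀ i → CanLand n ch i → lo ≤ i × i ≤ hi) ×
    s ≡ hi ∸ lo + 1

-- Call a configuration balanced if for every vertex u the subtrees of
-- its children u0 and u1 hold equally many chips, and for every t the subtree of u0
-- holds at least as many of the chips 1, …, t as that of u1. A firing at v adds one
-- chip under each child of v, the smaller one on the left, so every reachable
-- configuration is balanced. Halving the 2^n chips from the root downwards then shows
-- that in a stable balanced configuration every leaf (vertex of layer n+1) has exactly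
-- one chip in its subtree; left-heaviness puts chip 1 on the leftmost leaf, keeps each
-- of the chips 1, 2, 3 in the left half or on the first leaf of the right half, and
-- bounds the label of the chip on the second leaf by 2^(n-1) + 1.
--
-- A bijection between chips and leaves in which, for every vertex v and
-- every s, the leaf v0s receives a smaller chip than v1s is the outcome of the strategy
-- that fires, at each vertex v from the root down, the pairs of chips bound for v0s and
-- v1s. Rotating a chip onto a chosen leaf in the left-to-right or in the bit-reversed
-- numbering of the leaves gives all landings needed (at the leaves 2, 2^(n-1) + 1 and
-- 2^(n-1) + 2), and the mirror symmetry (left and right swapped, label c ↦ 2^n + 1 − c)
-- transports everything to the other end of the layer.

module Submission where

open import Defs
open import Data.Nat using (ℕ; zero; suc; pred; >-nonZero; _+_; _*_; _∸_; _^_; _≤_; _<_; z≤n; s≤s; _≟_; _<?_; _≤?_)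
open import Data.Nat.Properties
open import Algebra.Properties.CommutativeSemigroup +-commutativeSemigroup using (xy∙z≈xz∙y; xy∙z≈zy∙x)
open import Algebra.Properties.CommutativeMonoid.Sum +-0-commutativeMonoid
  using (sum; sum-cong-≗; ∑-distrib-+; sum-remove; sum-replicate-zero)
open import Data.Nat.Tactic.RingSolver using (solve-∀)
open import Data.Bool using (Bool; true; false; not) renaming (_≟_ to _≟ᵇ_)
open import Data.Bool.Properties using (not-injective)
open import Data.Fin using (Fin; toℕ; fromℕ<; opposite; punchIn; punchOut) renaming (zero to fzero; suc to fsuc)
open import Data.Fin.Properties
  using (toℕ<n; toℕ-injective; toℕ-fromℕ<; opposite-prop; opposite-involutive; punchInᵢ≢i; punchIn-punchOut)
  renaming (_≟_ to _≟ᶠ_; 0≢1+n to fzero≢fsuc; suc-injective to fsuc-injective)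
open import Data.List using ([]; _∷_; _++_; [_]; length; foldl; replicate; reverse; map; take; initLast; _∷ʳ′_)
open import Data.List.Properties
  using (++-assoc; ++-identityʳ; length-++; length-replicate; length-map; length-reverse; foldl-++; map-++;
         map-injective; reverse-++; reverse-involutive; unfold-reverse; ∷-injectiveʳ; ∷ʳ-injective; ≡-dec)
open import Data.List.Relation.Binary.Pointwise using (Pointwise-≡⇒≡; ≡⇒Pointwise-≡)
open import Data.List.Relation.Binary.Prefix.Heterogeneous using (Prefix; []; _∷_; _++ᵖ_)
open import Data.List.Relation.Binary.Prefix.Heterogeneous.Properties
  using (fromPointwise; toPointwise; prefix?; replicate⁺) renaming (trans to Prefix-trans)
open import Data.Product using (Σ; _×_; _,_; proj₁; proj₂)
open import Data.Sum using (_⊎_; inj₁; inj₂; [_,_]′)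
open import Data.Unit using (⊤; tt)
open import Data.Empty using (⊥; ⊥-elim)
open import Function using (_∘_)
open import Level using (0ℓ)
open import Relation.Nullary using (¬_; Dec; yes; no; contradiction)
open import Relation.Nullary.Decidable using (_×-dec_; _⊎-dec_)
open import Relation.Unary using (Pred; Decidable; _⊆_)
open import Relation.Binary using () renaming (Decidable to Decidable₂)
open import Relation.Binary.Definitions using (tri<; tri≈; tri>)
open import Relation.Binary.PropositionalEquality hiding ([_])
open import Relation.Binary.Construct.Closure.ReflexiveTransitive using (Star; ε; _◅_; _◅◅_; gmap)

𝟙 : {P : Set} → Dec P → ℕ
𝟙 (yes _) = 1
𝟙 (no _)  = 0

𝟙-yes : {P : Set} (P? : Dec P) → P → 𝟙 P? ≡ 1
𝟙-yes (yes _) _ = refl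
𝟙-yes (no ¬p) p = ⊥-elim (¬p p)

𝟙-no : {P : Set} (P? : Dec P) → ¬ P → 𝟙 P? ≡ 0
𝟙-no (yes p) ¬p = ⊥-elim (¬p p)
𝟙-no (no _)  _  = refl

𝟙-mono : {P Q : Set} (P? : Dec P) (Q? : Dec Q) → (P → Q) → 𝟙 P? ≤ 𝟙 Q?
𝟙-mono (yes p) (yes _) _   = ≤-refl
𝟙-mono (yes p) (no ¬q) P→Q = ⊥-elim (¬q (P→Q p))
𝟙-mono (no _)  _       _   = z≤n

𝟙-cong : {P Q : Set} (P? : Dec P) (Q? : Dec Q) → (P → Q) → (Q → P) → 𝟙 P? ≡ 𝟙 Q?
𝟙-cong P? Q? P→Q Q→P = ≤-antisym (𝟙-mono P? Q? P→Q) (𝟙-mono Q? P? Q→P)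

𝟙-⊎ : {P Q : Set} (P? : Dec P) (Q? : Dec Q) → (P → Q → ⊥) → 𝟙 (P? ⊎-dec Q?) ≡ 𝟙 P? + 𝟙 Q?
𝟙-⊎ (yes p) (yes q) disj = ⊥-elim (disj p q)
𝟙-⊎ (yes _) (no _)  _    = refl
𝟙-⊎ (no _)  (yes _) _    = refl
𝟙-⊎ (no _)  (no _)  _    = refl

sum-mono : ∀ {m} (f g : Fin m → ℕ) → (∀ i → f i ≤ g i) → sum f ≤ sum g
sum-mono {zero}  f g f≤g = z≤n
sum-mono {suc m} f g f≤g = +-mono-≤ (f≤g fzero) (sum-mono (f ∘ fsuc) (g ∘ fsuc) (f≤g ∘ fsuc))

sum-update : ∀ {m} (f g : Fin m → ℕ) (a : Fin m) → (∀ i → i ≢ a → f i ≡ g i) →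
             sum f + g a ≡ sum g + f a
sum-update {suc m} f g a f≗g = begin
  sum f + g a                     ≡⟨ cong (_+ g a) (sum-remove {i = a} f) ⟩
  f a + sum (f ∘ punchIn a) + g a ≡⟨ cong (λ s → f a + s + g a) (sum-cong-≗ λ j → f≗g (punchIn a j) (punchInᵢ≢i a j)) ⟩
  f a + sum (g ∘ punchIn a) + g a ≡⟨ xy∙z≈zy∙x (f a) _ (g a) ⟩
  g a + sum (g ∘ punchIn a) + f a ≡⟨ cong (_+ f a) (sum-remove {i = a} g) ⟨
  sum g + f a                     ∎
  where open ≡-Reasoning

sum-update₂ : ∀ {m} (f g : Fin m → ℕ) (a b : Fin m) → a ≢ b →
              (∀ i → i ≢ a → i ≢ b → f i ≡ g i) →
              sum f + g a + g b ≡ sum g + f a + f b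
sum-update₂ f g a b a≢b f≗g = begin
  sum f + g a + g b ≡⟨ cong (λ x → sum f + x + g b) h-a ⟨
  sum f + h a + g b ≡⟨ cong (_+ g b) (sum-update f h a f≗h) ⟩
  sum h + f a + g b ≡⟨ xy∙z≈xz∙y (sum h) (f a) (g b) ⟩
  sum h + g b + f a ≡⟨ cong (_+ f a) (sum-update h g b h≗g) ⟩
  sum g + h b + f a ≡⟨ cong (λ x → sum g + x + f a) h-b ⟩
  sum g + f b + f a ≡⟨ xy∙z≈xz∙y (sum g) (f b) (f a) ⟩
  sum g + f a + f b ∎
  where
  open ≡-Reasoning
  h : _ → ℕ
  h i with i ≟ᶠ a
  ... | yes _ = g i
  ... | no  _ = f i
  f≗h : ∀ i → i ≢ a → f i ≡ h i
  f≗h i i≢a with i ≟ᶠ a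
  ... | yes i≡a = contradiction i≡a i≢a
  ... | no  _   = refl
  h≗g : ∀ i → i ≢ b → h i ≡ g i
  h≗g i i≢b with i ≟ᶠ a
  ... | yes _   = refl
  ... | no  i≢a = f≗g i i≢a i≢b
  h-a : h a ≡ g a
  h-a with a ≟ᶠ a
  ... | yes _   = refl
  ... | no  a≢a = contradiction refl a≢a
  h-b : h b ≡ f b
  h-b = sym (f≗h b (a≢b ∘ sym))

count : ∀ {m} {P : Pred (Fin m) 0ℓ} → Decidable P → ℕ
count P? = sum (λ i → 𝟙 (P? i))

module _ {m : ℕ} {P Q : Pred (Fin m) 0ℓ} (P? : Decidable P) (Q? : Decidable Q) where

  count-mono : P ⊆ Q → count P? ≤ count Q?
  count-mono P⊆Q = sum-mono _ _ (λ i → 𝟙-mono (P? i) (Q? i) P⊆Q)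

  count-cong : P ⊆ Q → Q ⊆ P → count P? ≡ count Q?
  count-cong P⊆Q Q⊆P = sum-cong-≗ (λ i → 𝟙-cong (P? i) (Q? i) P⊆Q Q⊆P)

  count-⊎ : (∀ {i} → P i → Q i → ⊥) → count (λ i → P? i ⊎-dec Q? i) ≡ count P? + count Q?
  count-⊎ disj = trans (sum-cong-≗ (λ i → 𝟙-⊎ (P? i) (Q? i) disj)) (∑-distrib-+ (λ i → 𝟙 (P? i)) (λ i → 𝟙 (Q? i)))

sum-single : ∀ {m} (f : Fin m → ℕ) (a : Fin m) → f a ≤ sum f
sum-single {suc m} f a = ≤-trans (m≤m+n (f a) _) (≤-reflexive (sym (sum-remove {i = a} f)))

sum-pair : ∀ {m} (f : Fin m → ℕ) (a b : Fin m) → a ≢ b → f a + f b ≤ sum f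
sum-pair {suc m} f a b a≢b = begin
  f a + f b                           ≡⟨ cong (λ j → f a + f j) (punchIn-punchOut a≢b) ⟨
  f a + f (punchIn a (punchOut a≢b))  ≤⟨ +-monoʳ-≤ (f a) (sum-single (f ∘ punchIn a) _) ⟩
  f a + sum (f ∘ punchIn a)           ≡⟨ sum-remove {i = a} f ⟨
  sum f                               ∎
  where open ≤-Reasoning

count-none : ∀ {m} {P : Pred (Fin m) 0ℓ} (P? : Decidable P) → (∀ {i} → ¬ P i) → count P? ≡ 0
count-none {m} P? ¬P = trans (sum-cong-≗ (λ i → 𝟙-no (P? i) ¬P)) (sum-replicate-zero m)

count≤1 : ∀ {m} {P : Pred (Fin m) 0ℓ} (P? : Decidable P) → (∀ {i j} → P i → P j → i ≡ j) → count P? ≤ 1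
count≤1 {zero}  P? unique = z≤n
count≤1 {suc m} P? unique with P? fzero
... | yes p = ≤-reflexive (cong suc (count-none (P? ∘ fsuc) (λ q → fzero≢fsuc (unique p q))))
... | no  _ = count≤1 (P? ∘ fsuc) (λ p q → fsuc-injective (unique p q))

module _ {m : ℕ} {P : Pred (Fin m) 0ℓ} (P? : Decidable P) where

  count-≥1 : ∀ {i} → P i → 1 ≤ count P?
  count-≥1 {i} p = ≤-trans (≤-reflexive (sym (𝟙-yes (P? i) p))) (sum-single _ i)

  count≤1⇒unique : count P? ≤ 1 → ∀ {i j} → P i → P j → i ≡ j
  count≤1⇒unique ≤1 {i} {j} p q with i ≟ᶠ j
  ... | yes i≡j = i≡j
  ... | no  i≢j = ⊥-elim (<⇒≱ (s≤s ≤1) (begin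
    2                   ≡⟨ cong₂ _+_ (𝟙-yes (P? i) p) (𝟙-yes (P? j) q) ⟨
    𝟙 (P? i) + 𝟙 (P? j) ≤⟨ sum-pair _ i j i≢j ⟩
    count P?            ∎))
    where open ≤-Reasoning

count-all : ∀ m → count {m} (λ _ → yes tt) ≡ m
count-all zero    = refl
count-all (suc m) = cong suc (count-all m)

count-toℕ< : ∀ {m} t → t ≤ m → count {m} (λ i → toℕ i <? t) ≡ t
count-toℕ< {zero}  zero    _         = refl
count-toℕ< {suc m} zero    _         = count-none {suc m} (λ i → toℕ i <? 0) (λ ())
count-toℕ< {suc m} (suc t) (s≤s t≤m) =
  cong suc (trans (count-cong {m} (λ i → suc (toℕ i) <? suc t) (λ i → toℕ i <? t) ≤-pred s≤s) (count-toℕ< {m} t t≤m))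

length-child : ∀ v (b : Bool) → length (v ++ [ b ]) ≡ suc (length v)
length-child v b = trans (length-++ v) (+-comm (length v) 1)

_≟ᵥ_ : (u v : Vertex) → Dec (u ≡ v)
_≟ᵥ_ = ≡-dec _≟ᵇ_

infix 4 _≼_ _≼?_

-- u ≼ p: the vertex p lies in the subtree rooted at u.
_≼_ : Vertex → Vertex → Set
_≼_ = Prefix _≡_

_≼?_ : Decidable₂ _≼_
_≼?_ = prefix? _≟ᵇ_

≼-refl : ∀ {u} → u ≼ u
≼-refl = fromPointwise (≡⇒Pointwise-≡ refl)

≼-trans : ∀ {u v w} → u ≼ v → v ≼ w → u ≼ w
≼-trans = Prefix-trans trans

≼-++ : ∀ u t → u ≼ u ++ t
≼-++ u t = ≼-refl ++ᵖ t

≼-antisym-length : ∀ {u p} → u ≼ p → length u ≡ length p → u ≡ p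
≼-antisym-length u≼p eq = Pointwise-≡⇒≡ (toPointwise eq u≼p)

≼-++-child : ∀ u b w → u ++ [ b ] ≼ u ++ b ∷ w
≼-++-child u b w = subst (u ++ [ b ] ≼_) (++-assoc u [ b ] w) (≼-++ (u ++ [ b ]) w)

child-≼ : ∀ {u b p} → u ++ [ b ] ≼ p → u ≼ p
child-≼ {[]}    _            = []
child-≼ {_ ∷ u} (refl ∷ ≼p) = refl ∷ child-≼ {u} ≼p

≼-child : ∀ {w v} b → w ≼ v → w ≼ v ++ [ b ]
≼-child b w≼v = w≼v ++ᵖ [ b ]

child-⋠-parent : ∀ {u b} → ¬ (u ++ [ b ] ≼ u)
child-⋠-parent {[]}    ()
child-⋠-parent {_ ∷ u} (refl ∷ ≼u) = child-⋠-parent {u} ≼u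

children-disjoint : ∀ {u p} → u ++ [ false ] ≼ p → u ++ [ true ] ≼ p → ⊥
children-disjoint {[]}    (refl ∷ _)   (() ∷ _)
children-disjoint {_ ∷ u} (refl ∷ ≼₀) (refl ∷ ≼₁) = children-disjoint {u} ≼₀ ≼₁

children-≼-unique : ∀ {u β γ p} → u ++ [ β ] ≼ p → u ++ [ γ ] ≼ p → β ≡ γ
children-≼-unique {β = false} {false} _  _  = refl
children-≼-unique {β = true}  {true}  _  _  = refl
children-≼-unique {β = false} {true}  ≼₀ ≼₁ = contradiction ≼₁ (children-disjoint ≼₀)
children-≼-unique {β = true}  {false} ≼₁ ≼₀ = contradiction ≼₁ (children-disjoint ≼₀)

≼-self-or-child : ∀ {u p} → u ≼ p → u ≡ p ⊎ u ++ [ false ] ≼ p ⊎ u ++ [ true ] ≼ p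
≼-self-or-child {p = []}        []           = inj₁ refl
≼-self-or-child {p = false ∷ _} []           = inj₂ (inj₁ (refl ∷ []))
≼-self-or-child {p = true ∷ _}  []           = inj₂ (inj₂ (refl ∷ []))
≼-self-or-child                 (refl ∷ u≼p) with ≼-self-or-child u≼p
... | inj₁ refl       = inj₁ refl
... | inj₂ (inj₁ ≼₀) = inj₂ (inj₁ (refl ∷ ≼₀))
... | inj₂ (inj₂ ≼₁) = inj₂ (inj₂ (refl ∷ ≼₁))

≼-child⁻ : ∀ {w v b} → w ≼ v ++ [ b ] → w ≼ v ⊎ w ≡ v ++ [ b ]
≼-child⁻ {[]}               _            = inj₁ []
≼-child⁻ {_ ∷ w} {[]}       (refl ∷ [])  = inj₂ refl
≼-child⁻ {_ ∷ w} {_ ∷ v}    (refl ∷ ≼vb) with ≼-child⁻ {w} {v} ≼vb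
... | inj₁ w≼v = inj₁ (refl ∷ w≼v)
... | inj₂ refl = inj₂ refl

≼-root : ∀ {u} → [] ≼ u
≼-root = []

child-⋠-root : ∀ {u b} → ¬ (u ++ [ b ] ≼ [])
child-⋠-root {[]}    ()
child-⋠-root {_ ∷ _} ()

≼⇒take : ∀ {u p} → u ≼ p → take (length u) p ≡ u
≼⇒take []           = refl
≼⇒take (refl ∷ u≼p) = cong (_ ∷_) (≼⇒take u≼p)

branch-snoc : ∀ v β s (b : Bool) → v ++ β ∷ (s ++ [ b ]) ≡ (v ++ β ∷ s) ++ [ b ]
branch-snoc v β s b = sym (++-assoc v (β ∷ s) [ b ])

length-branch : ∀ v (β : Bool) s → length (v ++ β ∷ s) ≡ length v + suc (length s)
length-branch v β s = length-++ v

value : Vertex → ℕ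
value = foldl (λ acc d → 2 * acc + bit d) 0

foldl-value : ∀ a p → foldl (λ acc d → 2 * acc + bit d) a p ≡ a * 2 ^ length p + value p
foldl-value a []      = sym (trans (+-identityʳ _) (*-identityʳ a))
foldl-value a (d ∷ p) = begin
  foldl (λ acc d → 2 * acc + bit d) (2 * a + bit d) p ≡⟨ foldl-value (2 * a + bit d) p ⟩
  (2 * a + bit d) * 2 ^ length p + value p             ≡⟨ regroup a (bit d) (2 ^ length p) (value p) ⟩
  a * 2 ^ length (d ∷ p) + (bit d * 2 ^ length p + value p) ≡⟨ cong (a * 2 ^ length (d ∷ p) +_) (foldl-value (bit d) p) ⟨
  a * 2 ^ length (d ∷ p) + value (d ∷ p)              ∎
  where
  open ≡-Reasoning
  regroup : ∀ a b k v → (2 * a + b) * k + v ≡ a * (2 * k) + (b * k + v)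
  regroup = solve-∀

value-∷ : ∀ b p → value (b ∷ p) ≡ bit b * 2 ^ length p + value p
value-∷ b p = foldl-value (bit b) p

value-true∷ : ∀ p → value (true ∷ p) ≡ 2 ^ length p + value p
value-true∷ p = trans (value-∷ true p) (cong (_+ value p) (*-identityˡ _))

value-++ : ∀ u w → value (u ++ w) ≡ value u * 2 ^ length w + value w
value-++ u w = trans (foldl-++ _ 0 u w) (foldl-value (value u) w)

value-snoc : ∀ u b → value (u ++ [ b ]) ≡ 2 * value u + bit b
value-snoc u b = foldl-++ _ 0 u [ b ]

value< : ∀ p → value p < 2 ^ length p
value< []      = s≤s z≤n
value< (b ∷ p) = begin-strict
  value (b ∷ p)                    ≡⟨ value-∷ b p ⟩
  bit b * 2 ^ length p + value p   <⟨ +-monoʳ-< _ (value< p) ⟩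
  bit b * 2 ^ length p + 2 ^ length p ≤⟨ +-monoˡ-≤ _ (≤-trans (*-monoˡ-≤ (2 ^ length p) (bit≤1 b)) (≤-reflexive (*-identityˡ _))) ⟩
  2 ^ length p + 2 ^ length p      ≡⟨ cong (2 ^ length p +_) (+-identityʳ _) ⟨
  2 ^ length (b ∷ p)               ∎
  where
  open ≤-Reasoning
  bit≤1 : ∀ b → bit b ≤ 1
  bit≤1 false = z≤n
  bit≤1 true  = s≤s z≤n

value-leftmost : ∀ k → value (replicate k false) ≡ 0
value-leftmost zero    = refl
value-leftmost (suc k) = trans (value-∷ false (replicate k false)) (value-leftmost k)

value≡0⇒leftmost : ∀ p → value p ≡ 0 → p ≡ replicate (length p) false
value≡0⇒leftmost []          _  = refl
value≡0⇒leftmost (false ∷ p) eq = cong (false ∷_) (value≡0⇒leftmost p (trans (sym (value-∷ false p)) eq))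
value≡0⇒leftmost (true ∷ p)  eq = contradiction (trans (sym (value-true∷ p)) eq) (>⇒≢ (≤-trans (m^n>0 2 (length p)) (m≤m+n _ _)))

value-sorted : ∀ v s → value (v ++ false ∷ s) < value (v ++ true ∷ s)
value-sorted v s rewrite value-++ v (false ∷ s) | value-++ v (true ∷ s) | value-∷ false s | value-true∷ s =
  +-monoʳ-< (value v * 2 ^ length (false ∷ s)) (m<n+m (value s) (m^n>0 2 (length s)))

bits : ℕ → ℕ → Vertex
bits zero    k = []
bits (suc n) k with k <? 2 ^ n
... | yes _ = false ∷ bits n k
... | no  _ = true ∷ bits n (k ∸ 2 ^ n)

length-bits : ∀ n k → length (bits n k) ≡ n
length-bits zero    k = refl
length-bits (suc n) k with k <? 2 ^ n
... | yes _ = cong suc (length-bits n k)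
... | no  _ = cong suc (length-bits n (k ∸ 2 ^ n))

value-bits : ∀ n k → k < 2 ^ n → value (bits n k) ≡ k
value-bits zero    zero    _ = refl
value-bits zero    (suc k) (s≤s ())
value-bits (suc n) k k<2^n+1 with k <? 2 ^ n
... | yes k<2^n = trans (value-∷ false (bits n k)) (value-bits n k k<2^n)
... | no  k≮2^n = begin
  value (true ∷ bits n (k ∸ 2 ^ n))                  ≡⟨ value-true∷ (bits n (k ∸ 2 ^ n)) ⟩
  2 ^ length (bits n (k ∸ 2 ^ n)) + value (bits n (k ∸ 2 ^ n))
                                                     ≡⟨ cong₂ _+_ (cong (2 ^_) (length-bits n _)) (value-bits n (k ∸ 2 ^ n) rest<) ⟩
  2 ^ n + (k ∸ 2 ^ n)                                ≡⟨ m+[n∸m]≡n (≮⇒≥ k≮2^n) ⟩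
  k                                                  ∎
  where
  open ≡-Reasoning
  rest< : k ∸ 2 ^ n < 2 ^ n
  rest< = m<n+o⇒m∸n<o k (2 ^ n) {{>-nonZero (m^n>0 2 n)}} (subst (k <_) (cong (2 ^ n +_) (+-identityʳ _)) k<2^n+1)

bits-value : ∀ p → bits (length p) (value p) ≡ p
bits-value []      = refl
bits-value (b ∷ p) with value (b ∷ p) <? 2 ^ length p
bits-value (false ∷ p) | yes _ = cong (false ∷_) (trans (cong (bits (length p)) (value-∷ false p)) (bits-value p))
bits-value (true ∷ p)  | yes < = contradiction (subst (_< 2 ^ length p) (value-true∷ p) <) (λ lt → <⇒≱ lt (m≤m+n _ _))
bits-value (false ∷ p) | no ≮ = contradiction (subst (_< 2 ^ length p) (sym (value-∷ false p)) (value< p)) ≮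
bits-value (true ∷ p)  | no _ = cong (true ∷_) (trans (cong (bits (length p)) rest) (bits-value p))
  where
  rest : value (true ∷ p) ∸ 2 ^ length p ≡ value p
  rest = trans (cong (_∸ 2 ^ length p) (value-true∷ p)) (m+n∸m≡n (2 ^ length p) (value p))

value-injective : ∀ {p q} → length p ≡ length q → value p ≡ value q → p ≡ q
value-injective {p} {q} len eq = trans (sym (bits-value p)) (trans (cong₂ bits len eq) (bits-value q))

value-complement : ∀ p → value (map not p) + value p + 1 ≡ 2 ^ length p
value-complement []      = refl
value-complement (b ∷ p)
  rewrite value-∷ (not b) (map not p) | value-∷ b p | length-map not p = begin
  bit (not b) * 2 ^ length p + value (map not p) + (bit b * 2 ^ length p + value p) + 1
    ≡⟨ regroup (bit (not b)) (bit b) (2 ^ length p) (value (map not p)) (value p) ⟩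
  (bit (not b) + bit b) * 2 ^ length p + (value (map not p) + value p + 1)
    ≡⟨ cong₂ (λ x y → x * 2 ^ length p + y) (bit-not b) (value-complement p) ⟩
  1 * 2 ^ length p + 2 ^ length p
    ≡⟨ +-comm (1 * 2 ^ length p) (2 ^ length p) ⟩
  2 ^ suc (length p) ∎
  where
  open ≡-Reasoning
  regroup : ∀ x y k a c → x * k + a + (y * k + c) + 1 ≡ (x + y) * k + (a + c + 1)
  regroup = solve-∀
  bit-not : ∀ b → bit (not b) + bit b ≡ 1
  bit-not false = refl
  bit-not true  = refl

replicate-snoc : ∀ j (b : Bool) → replicate j b ++ [ b ] ≡ b ∷ replicate j b
replicate-snoc zero    b = refl
replicate-snoc (suc j) b = cong (b ∷_) (replicate-snoc j b)

reverse-replicate : ∀ j (b : Bool) → reverse (replicate j b) ≡ replicate j b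
reverse-replicate zero    b = refl
reverse-replicate (suc j) b = trans (unfold-reverse b (replicate j b)) (trans (cong (_++ [ b ]) (reverse-replicate j b)) (replicate-snoc j b))

branch≢leftmost : ∀ v s j → v ++ true ∷ s ≢ replicate j false
branch≢leftmost []      s (suc j) ()
branch≢leftmost (_ ∷ v) s (suc j) eq = branch≢leftmost v s j (∷-injectiveʳ eq)

branch-of-second-leaf : ∀ v s j → v ++ true ∷ s ≡ replicate j false ++ [ true ] → v ≡ replicate j false × s ≡ []
branch-of-second-leaf []          []      zero    refl = refl , refl
branch-of-second-leaf (_ ∷ v)     s       zero    eq   = contradiction (∷-injectiveʳ eq) (branch≢leftmost v s 0)
branch-of-second-leaf (false ∷ v) s       (suc j) eq with branch-of-second-leaf v s j (∷-injectiveʳ eq)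
... | refl , refl = refl , refl

length-replicate-∷ʳ : ∀ j b → length (replicate j false ++ [ b ]) ≡ suc j
length-replicate-∷ʳ j b = trans (length-child (replicate j false) b) (cong suc (length-replicate j))

value-second-leaf : ∀ j → value (replicate j false ++ [ true ]) ≡ 1
value-second-leaf j = trans (value-snoc (replicate j false) true) (cong (λ k → 2 * k + 1) (value-leftmost j))

value-first-right : ∀ j → value (true ∷ replicate j false) ≡ 2 ^ j
value-first-right j = trans (value-true∷ (replicate j false))
  (trans (cong₂ _+_ (cong (2 ^_) (length-replicate j)) (value-leftmost j)) (+-identityʳ _))

-- Chips under a vertex and the balance invariant

module Loads {n : ℕ} where

  chipsUnder : {P : Pred (Chip n) 0ℓ} → Decidable P → Config n → Vertex → ℕ
  chipsUnder P? c u = count (λ y → P? y ×-dec u ≼? c y)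

  all? : Decidable {A = Chip n} (λ _ → ⊤)
  all? _ = yes tt

  below? : (t : ℕ) → Decidable {A = Chip n} (λ y → toℕ y < t)
  below? t y = toℕ y <? t

  load : Config n → Vertex → ℕ
  load = chipsUnder all?

  loadBelow : ℕ → Config n → Vertex → ℕ
  loadBelow t = chipsUnder (below? t)

  module FireEffect {c c′ : Config n} {v : Vertex} {a b : Chip n}
    (ca : c a ≡ v) (cb : c b ≡ v) (ca′ : c′ a ≡ v ++ [ false ]) (cb′ : c′ b ≡ v ++ [ true ])
    (others : ∀ x → x ≢ a → x ≢ b → c′ x ≡ c x) (a≢b : a ≢ b)
    {P : Pred (Chip n) 0ℓ} (P? : Decidable P) where

    #[_] : Config n → Vertex → ℕ
    #[ d ] = chipsUnder P? d

    private
      at : Chip n → Vertex → Vertex → ℕ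
      at y w p = 𝟙 (P? y ×-dec w ≼? p)

      shift : ∀ w → #[ c′ ] w + at a w v + at b w v
                  ≡ #[ c ] w + at a w (v ++ [ false ]) + at b w (v ++ [ true ])
      shift w = begin
        #[ c′ ] w + at a w v + at b w v
          ≡⟨ cong₂ (λ p q → #[ c′ ] w + at a w p + at b w q) ca cb ⟨
        #[ c′ ] w + at a w (c a) + at b w (c b)
          ≡⟨ sum-update₂ _ _ a b a≢b (λ y y≢a y≢b → cong (at y w) (others y y≢a y≢b)) ⟩
        #[ c ] w + at a w (c′ a) + at b w (c′ b)
          ≡⟨ cong₂ (λ p q → #[ c ] w + at a w p + at b w q) ca′ cb′ ⟩
        #[ c ] w + at a w (v ++ [ false ]) + at b w (v ++ [ true ]) ∎
        where open ≡-Reasoning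

      cancel₂ : ∀ {x x′ y z} → x′ + y + z ≡ x + y + z → x′ ≡ x
      cancel₂ {x} {x′} {y} {z} eq = +-cancelʳ-≡ y x′ x (+-cancelʳ-≡ z (x′ + y) (x + y) eq)

    fire-other : ∀ u β → u ≢ v → #[ c′ ] (u ++ [ β ]) ≡ #[ c ] (u ++ [ β ])
    fire-other u β u≢v = cancel₂ (trans (shift (u ++ [ β ])) (cong₂ (λ p q → #[ c ] (u ++ [ β ]) + p + q) (same a false) (same b true)))
      where
      below-child⇒below : ∀ γ → u ++ [ β ] ≼ v ++ [ γ ] → u ++ [ β ] ≼ v
      below-child⇒below γ ≼vγ with ≼-child⁻ ≼vγ
      ... | inj₁ ≼v = ≼v
      ... | inj₂ eq = ⊥-elim (u≢v (proj₁ (∷ʳ-injective u v eq)))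
      same : ∀ y γ → at y (u ++ [ β ]) (v ++ [ γ ]) ≡ at y (u ++ [ β ]) v
      same y γ = 𝟙-cong _ _ (λ (p , ≼vγ) → p , below-child⇒below γ ≼vγ) (λ (p , ≼v) → p , ≼-child γ ≼v)

    private
      at-parent : ∀ y β → at y (v ++ [ β ]) v ≡ 0
      at-parent y β = 𝟙-no _ (child-⋠-parent ∘ proj₂)

      at-self : ∀ y w → at y w w ≡ 𝟙 (P? y)
      at-self y w = 𝟙-cong _ _ proj₁ (_, ≼-refl)

      shift-child : ∀ β → #[ c′ ] (v ++ [ β ])
                        ≡ #[ c ] (v ++ [ β ]) + at a (v ++ [ β ]) (v ++ [ false ]) + at b (v ++ [ β ]) (v ++ [ true ])
      shift-child β = trans (sym (trans (cong₂ (λ p q → #[ c′ ] (v ++ [ β ]) + p + q) (at-parent a β) (at-parent b β))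
                                        (trans (+-identityʳ _) (+-identityʳ _))))
                            (shift (v ++ [ β ]))

    fire-left : #[ c′ ] (v ++ [ false ]) ≡ #[ c ] (v ++ [ false ]) + 𝟙 (P? a)
    fire-left = trans (shift-child false) (trans
      (cong₂ (λ p q → #[ c ] (v ++ [ false ]) + p + q) (at-self a _) (𝟙-no _ (λ (_ , ≼₁) → children-disjoint ≼₁ ≼-refl)))
      (+-identityʳ _))

    fire-right : #[ c′ ] (v ++ [ true ]) ≡ #[ c ] (v ++ [ true ]) + 𝟙 (P? b)
    fire-right = trans (shift-child true) (trans
      (cong₂ (λ p q → #[ c ] (v ++ [ true ]) + p + q) (𝟙-no _ (λ (_ , ≼₀) → children-disjoint ≼-refl ≼₀)) (at-self b _))
      (cong (_+ 𝟙 (P? b)) (+-identityʳ _)))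

  record Balanced (c : Config n) : Set where
    field
      balanced   : ∀ u → load c (u ++ [ false ]) ≡ load c (u ++ [ true ])
      left-heavy : ∀ t u → loadBelow t c (u ++ [ true ]) ≤ loadBelow t c (u ++ [ false ])

  initial-balanced : Balanced (initial n)
  initial-balanced = record
    { balanced   = λ u → trans (empty all? u false) (sym (empty all? u true))
    ; left-heavy = λ t u → ≤-reflexive (trans (empty (below? t) u true) (sym (empty (below? t) u false)))
    }
    where
    empty : ∀ {P} (P? : Decidable P) u β → chipsUnder P? (initial n) (u ++ [ β ]) ≡ 0
    empty P? u β = count-none (λ y → P? y ×-dec u ++ [ β ] ≼? []) (child-⋠-root ∘ proj₂)

  fire-balanced : ∀ {c c′ : Config n} → Fires {n} c c′ → Balanced c → Balanced c′
  fire-balanced {c} {c′} (fire v a b a<b ca cb ca′ cb′ others) bal = record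
    { balanced = balanced′ ; left-heavy = left-heavy′ }
    where
    open Balanced bal
    a≢b : a ≢ b
    a≢b a≡b = <-irrefl (cong toℕ a≡b) a<b
    module E {P : Pred (Chip n) 0ℓ} (P? : Decidable P) = FireEffect ca cb ca′ cb′ others a≢b P?
    module L = E all?
    module B t = E (below? t)

    balanced′ : ∀ u → load c′ (u ++ [ false ]) ≡ load c′ (u ++ [ true ])
    balanced′ u with u ≟ᵥ v
    ... | no u≢v = trans (L.fire-other u false u≢v) (trans (balanced u) (sym (L.fire-other u true u≢v)))
    ... | yes refl = trans L.fire-left (trans (cong (_+ 1) (balanced u)) (sym L.fire-right))

    left-heavy′ : ∀ t u → loadBelow t c′ (u ++ [ true ]) ≤ loadBelow t c′ (u ++ [ false ])
    left-heavy′ t u with u ≟ᵥ v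
    ... | no u≢v = subst₂ _≤_ (sym (B.fire-other t u true u≢v)) (sym (B.fire-other t u false u≢v)) (left-heavy t u)
    ... | yes refl = subst₂ _≤_ (sym (B.fire-right t)) (sym (B.fire-left t))
                       (+-mono-≤ (left-heavy t u) (𝟙-mono (toℕ b <? t) (toℕ a <? t) (<-trans a<b)))

  reachable-balanced : ∀ {c : Config n} → Reachable n c → Balanced c
  reachable-balanced = go initial-balanced
    where
    go : ∀ {c d : Config n} → Balanced c → Star (Fires {n}) c d → Balanced d
    go bal ε        = bal
    go bal (f ◅ fs) = go (fire-balanced f bal) fs

  occupants : {P : Pred (Chip n) 0ℓ} → Decidable P → Config n → Vertex → ℕ
  occupants P? c u = count (λ y → P? y ×-dec c y ≟ᵥ u)

  chipsUnder-split : ∀ {P : Pred (Chip n) 0ℓ} (P? : Decidable P) c u →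
    chipsUnder P? c u ≡ occupants P? c u + (chipsUnder P? c (u ++ [ false ]) + chipsUnder P? c (u ++ [ true ]))
  chipsUnder-split {P} P? c u = begin
    chipsUnder P? c u
      ≡⟨ count-cong (λ y → P? y ×-dec u ≼? c y) (λ y → at y ⊎-dec (left y ⊎-dec right y)) to from ⟩
    count (λ y → at y ⊎-dec (left y ⊎-dec right y))
      ≡⟨ count-⊎ at (λ y → left y ⊎-dec right y) at-not-below ⟩
    occupants P? c u + count (λ y → left y ⊎-dec right y)
      ≡⟨ cong (occupants P? c u +_) (count-⊎ left right (λ (_ , ≼₀) (_ , ≼₁) → children-disjoint ≼₀ ≼₁)) ⟩
    occupants P? c u + (chipsUnder P? c (u ++ [ false ]) + chipsUnder P? c (u ++ [ true ])) ∎
    where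
    open ≡-Reasoning
    At Left Right : Pred (Chip n) 0ℓ
    At y = P y × c y ≡ u
    Left y = P y × u ++ [ false ] ≼ c y
    Right y = P y × u ++ [ true ] ≼ c y
    at : Decidable At
    at y = P? y ×-dec c y ≟ᵥ u
    left : Decidable Left
    left y = P? y ×-dec u ++ [ false ] ≼? c y
    right : Decidable Right
    right y = P? y ×-dec u ++ [ true ] ≼? c y
    to : ∀ {y} → P y × u ≼ c y → At y ⊎ Left y ⊎ Right y
    to (p , u≼) with ≼-self-or-child u≼
    ... | inj₁ refl      = inj₁ (p , refl)
    ... | inj₂ (inj₁ ≼₀) = inj₂ (inj₁ (p , ≼₀))
    ... | inj₂ (inj₂ ≼₁) = inj₂ (inj₂ (p , ≼₁))
    from : ∀ {y} → At y ⊎ Left y ⊎ Right y → P y × u ≼ c y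
    from (inj₁ (p , refl))        = p , ≼-refl
    from (inj₂ (inj₁ (p , ≼₀))) = p , child-≼ ≼₀
    from (inj₂ (inj₂ (p , ≼₁))) = p , child-≼ ≼₁
    at-not-below : ∀ {y} → At y → Left y ⊎ Right y → ⊥
    at-not-below (_ , refl) (inj₁ (_ , ≼₀)) = child-⋠-parent ≼₀
    at-not-below (_ , refl) (inj₂ (_ , ≼₁)) = child-⋠-parent ≼₁

  children-≤ : ∀ {P : Pred (Chip n) 0ℓ} (P? : Decidable P) c u →
    chipsUnder P? c (u ++ [ false ]) + chipsUnder P? c (u ++ [ true ]) ≤ chipsUnder P? c u
  children-≤ P? c u = ≤-trans (m≤n+m _ (occupants P? c u)) (≤-reflexive (sym (chipsUnder-split P? c u)))

  loadBelow≤load : ∀ t c u → loadBelow t c u ≤ load c u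
  loadBelow≤load t c u = count-mono (λ y → below? t y ×-dec u ≼? c y) (λ y → all? y ×-dec u ≼? c y) (λ (_ , ≼y) → tt , ≼y)

  loadBelow-root : ∀ {t} c → t ≤ 2 ^ n → loadBelow t c [] ≡ t
  loadBelow-root {t} c t≤ = trans (count-cong (λ y → below? t y ×-dec [] ≼? c y) (below? t) proj₁ (_, ≼-root)) (count-toℕ< t t≤)

-- Stable balanced configurations

halve : ∀ {a s K} → a ≤ 1 → a + (s + s) ≡ 2 * K → a ≡ 0 × s ≡ K
halve {zero}  {s} {K} _ eq = refl , *-cancelˡ-≡ s K 2 (trans (cong (s +_) (+-identityʳ s)) eq)
halve {suc zero} {s} {K} _ eq = contradiction (sym (trans (cong (λ x → suc (s + x)) (+-identityʳ s)) eq)) (even≢odd K s)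
halve {suc (suc _)} (s≤s ())

module StableStructure {n : ℕ} {c : Config n} (bal : Loads.Balanced {n} c) (stable : Stable {n} c) where
  open Loads {n}
  open Balanced bal

  occupied-by-one : ∀ u → occupants all? c u ≤ 1
  occupied-by-one u = count≤1 (λ y → all? y ×-dec c y ≟ᵥ u) (λ (_ , cy≡u) (_ , cz≡u) → stable _ _ (trans cy≡u (sym cz≡u)))

  load-root : load c [] ≡ 2 ^ n
  load-root = trans (count-cong (λ y → all? y ×-dec [] ≼? c y) all? proj₁ (λ p → p , ≼-root)) (count-all (2 ^ n))

  load-split : ∀ u → load c u ≡ occupants all? c u + (load c (u ++ [ true ]) + load c (u ++ [ true ]))
  load-split u = trans (chipsUnder-split all? c u) (cong (λ x → occupants all? c u + (x + load c (u ++ [ true ]))) (balanced u))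

  halve-load : ∀ u K → load c u ≡ 2 * K → occupants all? c u ≡ 0 × (∀ β → load c (u ++ [ β ]) ≡ K)
  halve-load u K eq with halve (occupied-by-one u) (trans (sym (load-split u)) eq)
  ... | unoccupied , half = unoccupied , λ { false → trans (balanced u) half ; true → half }

  load-depth : ∀ u k → length u + k ≡ n → load c u ≡ 2 ^ k
  load-depth u k = go (length u) u refl k
    where
    go : ∀ j u → length u ≡ j → ∀ k → j + k ≡ n → load c u ≡ 2 ^ k
    go zero    []  _   k refl = load-root
    go (suc j) u   len k eq with initLast u
    ... | []       = contradiction len 0≢1+n
    ... | u′ ∷ʳ′ β = proj₂ (halve-load u′ (2 ^ k) (go j u′ len′ (suc k) (trans (+-suc j k) eq))) β
      where
      len′ : length u′ ≡ j
      len′ = suc-injective (trans (sym (length-child u′ β)) len)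

  leaf-load : ∀ u → length u ≡ n → load c u ≡ 1
  leaf-load u len = load-depth u 0 (trans (+-identityʳ _) len)

  unoccupied-above : ∀ u → length u < n → occupants all? c u ≡ 0
  unoccupied-above u |u|<n with m≤n⇒∃[o]m+o≡n |u|<n
  ... | k , eq = proj₁ (halve-load u (2 ^ k) (load-depth u (suc k) (trans (+-suc (length u) k) eq)))

  depth≥n : ∀ y → n ≤ length (c y)
  depth≥n y with length (c y) <? n
  ... | no  ≮ = ≮⇒≥ ≮
  ... | yes < = contradiction (unoccupied-above (c y) <) (>⇒≢ (count-≥1 (λ z → all? z ×-dec c z ≟ᵥ c y) (_ , refl)))

  split-above : ∀ {P : Pred (Chip n) 0ℓ} (P? : Decidable P) u → length u < n →
    chipsUnder P? c u ≡ chipsUnder P? c (u ++ [ false ]) + chipsUnder P? c (u ++ [ true ])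
  split-above P? u |u|<n = trans (chipsUnder-split P? c u) (cong (_+ children) (n≤0⇒n≡0 (begin
    occupants P? c u   ≤⟨ count-mono (λ y → P? y ×-dec c y ≟ᵥ u) (λ y → all? y ×-dec c y ≟ᵥ u) (λ (_ , e) → tt , e) ⟩
    occupants all? c u ≡⟨ unoccupied-above u |u|<n ⟩
    0                  ∎)))
    where
    open ≤-Reasoning
    children = chipsUnder P? c (u ++ [ false ]) + chipsUnder P? c (u ++ [ true ])

  alone-under : ∀ u → length u ≡ n → ∀ {x y} → u ≼ c x → u ≼ c y → x ≡ y
  alone-under u len u≼x u≼y =
    count≤1⇒unique (λ z → all? z ×-dec u ≼? c z) (≤-reflexive (leaf-load u len)) (tt , u≼x) (tt , u≼y)

  -- A chip numbered below t under the right child would force a second one under the left child.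
  lone-small-chip-goes-left : ∀ {t x} u w → toℕ x < t → loadBelow t c u ≤ 1 → c x ≡ u ++ w →
                              w ≡ replicate (length w) false
  lone-small-chip-goes-left u []          _   _  _  = refl
  lone-small-chip-goes-left {t} {x} u (true ∷ w) x<t ≤1 cx = contradiction (begin
    2                                                           ≤⟨ +-mono-≤ (≤-trans right≥1 (left-heavy t u)) right≥1 ⟩
    loadBelow t c (u ++ [ false ]) + loadBelow t c (u ++ [ true ]) ≤⟨ children-≤ (below? t) c u ⟩
    loadBelow t c u                                             ≤⟨ ≤1 ⟩
    1                                                           ∎) (λ { (s≤s ()) })
    where
    open ≤-Reasoning
    right≥1 : 1 ≤ loadBelow t c (u ++ [ true ])
    right≥1 = count-≥1 (λ y → below? t y ×-dec u ++ [ true ] ≼? c y) (x<t , subst (u ++ [ true ] ≼_) (sym cx) (≼-++-child u true w))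
  lone-small-chip-goes-left {t} u (false ∷ w) x<t ≤1 cx =
    cong (false ∷_) (lone-small-chip-goes-left (u ++ [ false ]) w x<t
      (≤-trans (m≤m+n _ _) (≤-trans (children-≤ (below? t) c u) ≤1))
      (trans cx (sym (++-assoc u [ false ] w))))

  chip-zero-leftmost : ∀ x → toℕ x ≡ 0 → c x ≡ replicate (length (c x)) false
  chip-zero-leftmost x x≡0 = lone-small-chip-goes-left [] (c x) (subst (_< 1) (sym x≡0) (s≤s z≤n))
    (≤-reflexive (loadBelow-root c (m^n>0 2 n))) refl

  leftmost-leaf-holds-chip-zero : ∀ x → c x ≡ replicate n false → toℕ x ≡ 0
  leftmost-leaf-holds-chip-zero x cx =
    trans (cong toℕ (alone-under (replicate n false) (length-replicate n) x-below first-below)) (toℕ-fromℕ< 0<2^n)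
    where
    0<2^n = m^n>0 2 n
    first = fromℕ< 0<2^n
    x-below : replicate n false ≼ c x
    x-below = subst (replicate n false ≼_) (sym cx) ≼-refl
    first-below : replicate n false ≼ c first
    first-below = subst (replicate n false ≼_) (sym (chip-zero-leftmost first (toℕ-fromℕ< 0<2^n))) (replicate⁺ (depth≥n first) refl)

  small-chip-in-right-half-is-leftmost : 3 ≤ 2 ^ n → ∀ {x} w → toℕ x < 3 → c x ≡ true ∷ w →
                                        w ≡ replicate (length w) false
  small-chip-in-right-half-is-leftmost 3≤2^n w x<3 cx = lone-small-chip-goes-left [ true ] w x<3 right≤1 cx
    where
    right≤1 : loadBelow 3 c [ true ] ≤ 1
    right≤1 = half≤1 (begin
      loadBelow 3 c [ true ] + loadBelow 3 c [ true ]  ≤⟨ +-monoˡ-≤ _ (left-heavy 3 []) ⟩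
      loadBelow 3 c [ false ] + loadBelow 3 c [ true ] ≤⟨ children-≤ (below? 3) c [] ⟩
      loadBelow 3 c []                                 ≡⟨ loadBelow-root c 3≤2^n ⟩
      3                                                ∎)
      where
      open ≤-Reasoning
      half≤1 : ∀ {k} → k + k ≤ 3 → k ≤ 1
      half≤1 {zero}        _ = z≤n
      half≤1 {suc zero}    _ = ≤-refl
      half≤1 {suc (suc k)} (s≤s (s≤s le)) = contradiction (≤-trans (m≤n+m (suc (suc k)) k) le) λ { (s≤s ()) }

  loadBelow-halving : ∀ t k u → length u + k ≤ n → loadBelow t c u ≤ 2 ^ k * loadBelow t c (u ++ replicate k false)
  loadBelow-halving t zero u _ = ≤-reflexive (sym (trans (+-identityʳ _) (cong (loadBelow t c) (++-identityʳ u))))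
  loadBelow-halving t (suc k) u le = begin
    loadBelow t c u                                 ≡⟨ split-above (below? t) u (<-≤-trans (m<m+n (length u) (s≤s z≤n)) le) ⟩
    left + loadBelow t c (u ++ [ true ])            ≤⟨ +-monoʳ-≤ left (left-heavy t u) ⟩
    left + left                                     ≡⟨ cong (left +_) (+-identityʳ left) ⟨
    2 * left                                        ≤⟨ *-monoʳ-≤ 2 (loadBelow-halving t k (u ++ [ false ]) le′) ⟩
    2 * (2 ^ k * loadBelow t c (u′ ++ replicate k false)) ≡⟨ *-assoc 2 (2 ^ k) _ ⟨
    2 ^ suc k * loadBelow t c (u′ ++ replicate k false)
                                                    ≡⟨ cong (λ p → 2 ^ suc k * loadBelow t c p) (++-assoc u [ false ] (replicate k false)) ⟩
    2 ^ suc k * loadBelow t c (u ++ replicate (suc k) false) ∎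
    where
    open ≤-Reasoning
    u′ = u ++ [ false ]
    left = loadBelow t c u′
    le′ : length u′ + k ≤ n
    le′ = ≤-trans (≤-reflexive (trans (cong (_+ k) (length-child u false)) (sym (+-suc (length u) k)))) le

  chip-on-second-leaf-≤ : ∀ m x → suc m ≡ n → c x ≡ replicate m false ++ [ true ] → toℕ x ≤ 2 ^ m
  chip-on-second-leaf-≤ m x refl cx = begin
    toℕ x                                             ≡⟨ loadBelow-root c (<⇒≤ (toℕ<n x)) ⟨
    loadBelow (toℕ x) c []                            ≤⟨ loadBelow-halving (toℕ x) m [] (n≤1+n m) ⟩
    2 ^ m * loadBelow (toℕ x) c w                     ≡⟨ cong (2 ^ m *_) (split-above (below? (toℕ x)) w |w|<n) ⟩
    2 ^ m * (loadBelow (toℕ x) c (w ++ [ false ]) + loadBelow (toℕ x) c (w ++ [ true ]))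
                                                      ≤⟨ *-monoʳ-≤ (2 ^ m) (+-mono-≤ left≤1 (≤-reflexive right≡0)) ⟩
    2 ^ m * 1                                         ≡⟨ *-identityʳ _ ⟩
    2 ^ m                                             ∎
    where
    open ≤-Reasoning
    w = replicate m false
    |w|<n : length w < suc m
    |w|<n = ≤-reflexive (cong suc (length-replicate m))
    left≤1 : loadBelow (toℕ x) c (w ++ [ false ]) ≤ 1
    left≤1 = ≤-trans (loadBelow≤load (toℕ x) c (w ++ [ false ])) (≤-reflexive (leaf-load (w ++ [ false ]) (length-replicate-∷ʳ m false)))
    right≡0 : loadBelow (toℕ x) c (w ++ [ true ]) ≡ 0
    right≡0 = count-none (λ y → below? (toℕ x) y ×-dec w ++ [ true ] ≼? c y) λ (y<x , ≼y) →
      <-irrefl (cong toℕ (alone-under (w ++ [ true ]) (length-replicate-∷ʳ m true) ≼y (subst (w ++ [ true ] ≼_) (sym cx) ≼-refl))) y<x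

-- Where chips cannot land

chip-zero-lands-first : ∀ {n x i} → toℕ x ≡ 0 → CanLand n x i → i ≡ 1
chip-zero-lands-first {x = x} x≡0 (c , reach , stable , _ , refl) =
  cong suc (trans (cong value (chip-zero-leftmost x x≡0)) (value-leftmost (length (c x))))
  where open StableStructure (Loads.reachable-balanced reach) stable

other-chips-land-after-first : ∀ {n x i} → toℕ x ≢ 0 → CanLand n x i → 2 ≤ i
other-chips-land-after-first {x = x} x≢0 (c , reach , stable , len , refl) = s≤s (n≢0⇒n>0 λ v≡0 →
  x≢0 (leftmost-leaf-holds-chip-zero x (trans (value≡0⇒leftmost (c x) v≡0) (cong (λ k → replicate k false) len))))
  where open StableStructure (Loads.reachable-balanced reach) stable

small-chips-land-≤-middle : ∀ {m x i} → toℕ x < 3 → CanLand (suc (suc m)) x i → i ≤ suc (2 ^ suc m)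
small-chips-land-≤-middle {m} {x} x<3 (c , reach , stable , len , refl) with c x in cx
... | false ∷ w = s≤s (subst (λ k → value w ≤ 2 ^ k) (suc-injective len) (<⇒≤ (value< w)))
... | true ∷ w  = s≤s (≤-reflexive (begin
  value (true ∷ w)                          ≡⟨ cong value (cong (true ∷_) (small-chip-in-right-half-is-leftmost 3≤2^n w x<3 cx)) ⟩
  value (true ∷ replicate (length w) false) ≡⟨ value-first-right (length w) ⟩
  2 ^ length w                              ≡⟨ cong (2 ^_) (suc-injective len) ⟩
  2 ^ suc m                                 ∎))
  where
  open StableStructure (Loads.reachable-balanced reach) stable
  open ≡-Reasoning
  3≤2^n : 3 ≤ 2 ^ suc (suc m)
  3≤2^n = ≤-trans (s≤s (s≤s (s≤s z≤n))) (^-monoʳ-≤ 2 {2} {suc (suc m)} (s≤s (s≤s z≤n)))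

lands-second⇒≤ : ∀ {m x} → CanLand (suc m) x 2 → toℕ x ≤ 2 ^ m
lands-second⇒≤ {m} {x} (c , reach , stable , len , idx) = chip-on-second-leaf-≤ m x refl
  (value-injective (trans len (sym (length-replicate-∷ʳ m true))) (trans (suc-injective idx) (sym (value-second-leaf m))))
  where open StableStructure (Loads.reachable-balanced reach) stable

-- Mirror symmetry

landing-bounds : ∀ {n x i} → CanLand n x i → 1 ≤ i × i ≤ 2 ^ n
landing-bounds {n} {x} (c , _ , _ , len , refl) = s≤s z≤n , subst (λ k → suc (value (c x)) ≤ 2 ^ k) len (value< (c x))

index-flip : ∀ p → index (map not p) ≡ suc (2 ^ length p) ∸ index p
index-flip p = sym (begin
  suc (2 ^ length p) ∸ suc (value p)               ≡⟨ cong (_∸ value p) (value-complement p) ⟨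
  value (map not p) + value p + 1 ∸ value p        ≡⟨ cong (_∸ value p) (+-comm (value (map not p) + value p) 1) ⟩
  suc (value (map not p) + value p) ∸ value p      ≡⟨ m+n∸n≡m (suc (value (map not p))) (value p) ⟩
  index (map not p)                                ∎)
  where open ≡-Reasoning

module _ {n : ℕ} where

  mirror : Config n → Config n
  mirror c x = map not (c (opposite x))

  opposite-injective : ∀ {x y : Chip n} → opposite x ≡ opposite y → x ≡ y
  opposite-injective {x} {y} eq = trans (sym (opposite-involutive x)) (trans (cong opposite eq) (opposite-involutive y))

  opposite-reverses-< : ∀ {x y : Chip n} → toℕ x < toℕ y → toℕ (opposite y) < toℕ (opposite x)
  opposite-reverses-< {x} {y} x<y =
    subst₂ _<_ (sym (opposite-prop y)) (sym (opposite-prop x)) (∸-monoʳ-< (s≤s x<y) (toℕ<n y))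

  mirror-opposite : ∀ c (x : Chip n) → mirror c (opposite x) ≡ map not (c x)
  mirror-opposite c x = cong (map not ∘ c) (opposite-involutive x)

  fire-mirror : ∀ {c c′ : Config n} → Fires {n} c c′ → Fires {n} (mirror c) (mirror c′)
  fire-mirror {c} {c′} (fire v a b a<b ca cb ca′ cb′ others) =
    fire (map not v) (opposite b) (opposite a) (opposite-reverses-< a<b)
      (trans (mirror-opposite c b) (cong (map not) cb))
      (trans (mirror-opposite c a) (cong (map not) ca))
      (trans (mirror-opposite c′ b) (trans (cong (map not) cb′) (map-++ not v [ true ])))
      (trans (mirror-opposite c′ a) (trans (cong (map not) ca′) (map-++ not v [ false ])))
      (λ x x≢b′ x≢a′ → cong (map not) (others (opposite x) (x≢a′ ∘ flip-eq) (x≢b′ ∘ flip-eq)))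
    where
    flip-eq : ∀ {x y} → opposite x ≡ y → x ≡ opposite y
    flip-eq {x} refl = sym (opposite-involutive x)

  stable-mirror : ∀ {c : Config n} → Stable {n} c → Stable {n} (mirror c)
  stable-mirror stable a b eq = opposite-injective (stable (opposite a) (opposite b) (map-injective not-injective eq))

  CanLand-mirror : ∀ {x i} → CanLand n x i → CanLand n (opposite x) (suc (2 ^ n) ∸ i)
  CanLand-mirror {x} (c , reach , stable , len , idx) =
    mirror c , gmap mirror fire-mirror reach , stable-mirror stable ,
    trans (cong length (mirror-opposite c x)) (trans (length-map not (c x)) len) ,
    trans (cong index (mirror-opposite c x))
      (trans (index-flip (c x)) (cong₂ (λ k i → suc (2 ^ k) ∸ i) len idx))

  CanLand-mirror⁻ : ∀ {x i} → CanLand n (opposite x) i → CanLand n x (suc (2 ^ n) ∸ i)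
  CanLand-mirror⁻ {x} land = subst (λ y → CanLand n y _) (opposite-involutive x) (CanLand-mirror land)

  Spread-mirror : ∀ {x s} → Spread n x s → Spread n (opposite x) s
  Spread-mirror {x} (lo , hi , land-lo , land-hi , bounds , s≡) =
    K ∸ hi , K ∸ lo , CanLand-mirror land-hi , CanLand-mirror land-lo , bounds′ ,
    trans s≡ (cong (_+ 1) (sym (flip-width (proj₂ (bounds lo land-lo)) (≤-trans (proj₂ (landing-bounds land-hi)) (n≤1+n _)))))
    where
    K = suc (2 ^ n)
    flip-width : ∀ {K hi lo} → lo ≤ hi → hi ≤ K → (K ∸ lo) ∸ (K ∸ hi) ≡ hi ∸ lo
    flip-width {K} {hi} {zero}   _         hi≤K      = m∸[m∸n]≡n hi≤K
    flip-width {suc K} {suc hi} {suc lo} (s≤s lo≤hi) (s≤s hi≤K) = flip-width lo≤hi hi≤K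
    bounds′ : ∀ i → CanLand n (opposite x) i → K ∸ hi ≤ i × i ≤ K ∸ lo
    bounds′ i land = subst (K ∸ hi ≤_) K∸K∸i (∸-monoʳ-≤ K (proj₂ b)) , subst (_≤ K ∸ lo) K∸K∸i (∸-monoʳ-≤ K (proj₁ b))
      where
      b = bounds (K ∸ i) (CanLand-mirror⁻ land)
      K∸K∸i : K ∸ (K ∸ i) ≡ i
      K∸K∸i = m∸[m∸n]≡n (≤-trans (proj₂ (landing-bounds land)) (n≤1+n _))

Spread-opposite⁻ : ∀ {n x s} → Spread n (opposite x) s → Spread n x s
Spread-opposite⁻ {n} {x} {s} sp = subst (λ y → Spread n y s) (opposite-involutive x) (Spread-mirror sp)

-- Sorted labellings are realisable

module Reach {n : ℕ} where

  -- Reachability up to pointwise equality, since configurations are functions and there is no function extensionality.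
  infix 4 _↠_
  _↠_ : Config n → Config n → Set
  c ↠ d = Σ (Config n) λ d′ → Star (Fires {n}) c d′ × (∀ x → d′ x ≡ d x)

  Fires-respˡ : ∀ {c c′ d : Config n} → (∀ x → c x ≡ c′ x) → Fires {n} c d → Fires {n} c′ d
  Fires-respˡ c≗c′ (fire v a b a<b ca cb ca′ cb′ others) =
    fire v a b a<b (trans (sym (c≗c′ a)) ca) (trans (sym (c≗c′ b)) cb) ca′ cb′
      (λ x x≢a x≢b → trans (others x x≢a x≢b) (c≗c′ x))

  ↠-refl : ∀ {c d : Config n} → (∀ x → c x ≡ d x) → c ↠ d
  ↠-refl {c} c≗d = c , ε , c≗d

  ↠-fire : ∀ {c d : Config n} → Fires {n} c d → c ↠ d
  ↠-fire {d = d} f = d , f ◅ ε , λ _ → refl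

  ↠-trans : ∀ {c d e : Config n} → c ↠ d → d ↠ e → c ↠ e
  ↠-trans (d′ , c→d′ , d′≗d) (e′ , ε , e′≗e)       = d′ , c→d′ , λ x → trans (d′≗d x) (e′≗e x)
  ↠-trans (d′ , c→d′ , d′≗d) (e′ , f ◅ fs , e′≗e) = e′ , c→d′ ◅◅ (Fires-respˡ (sym ∘ d′≗d) f ◅ fs) , e′≗e

-- Leaf p receives the chip numbered rank p (its label minus one).
record SortedLabelling (n : ℕ) : Set where
  field
    rank        : Vertex → ℕ
    leaf        : ℕ → Vertex
    leaf-length : ∀ {k} → k < 2 ^ n → length (leaf k) ≡ n
    rank-leaf   : ∀ {k} → k < 2 ^ n → rank (leaf k) ≡ k
    leaf-rank   : ∀ {p} → length p ≡ n → leaf (rank p) ≡ p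
    rank<       : ∀ {p} → length p ≡ n → rank p < 2 ^ n
    sorted      : ∀ v s → length v + suc (length s) ≡ n → rank (v ++ false ∷ s) < rank (v ++ true ∷ s)

Region : Vertex → Vertex → Vertex → Set
Region v s p = Σ Bool λ b → v ++ b ∷ s ≼ p

region? : ∀ v s p → Dec (Region v s p)
region? v s p with v ++ false ∷ s ≼? p | v ++ true ∷ s ≼? p
... | yes q | _     = yes (false , q)
... | no  _ | yes q = yes (true , q)
... | no ¬q | no ¬r = no λ { (false , q) → ¬q q ; (true , r) → ¬r r }

region-child : ∀ {v s p} → Region v s p → Σ Bool λ b → v ++ [ b ] ≼ p
region-child {v} {s} (b , q) = b , ≼-trans (≼-++-child v b s) q

region-shrink : ∀ {v s b p} → Region v (s ++ [ b ]) p → Region v s p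
region-shrink {v} {s} {b} (β , q) = β , child-≼ (subst (_≼ _) (branch-snoc v β s b) q)

region-disjoint : ∀ {v s p} → Region v (s ++ [ false ]) p → Region v (s ++ [ true ]) p → ⊥
region-disjoint {v} {s} {p} (β , q) (γ , r) with children-≼-unique (≼-trans (≼-++-child v β _) q) (≼-trans (≼-++-child v γ _) r)
... | refl = children-disjoint (subst (_≼ p) (branch-snoc v β s false) q) (subst (_≼ p) (branch-snoc v β s true) r)

region-split : ∀ {v s p} → Region v s p → length v + suc (length s) < length p →
               Region v (s ++ [ false ]) p ⊎ Region v (s ++ [ true ]) p
region-split {v} {s} {p} (β , q) shorter with ≼-self-or-child q
... | inj₁ refl      = contradiction (length-branch v β s) (<⇒≢ shorter ∘ sym)
... | inj₂ (inj₁ q₀) = inj₁ (β , subst (_≼ p) (sym (branch-snoc v β s false)) q₀)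
... | inj₂ (inj₂ q₁) = inj₂ (β , subst (_≼ p) (sym (branch-snoc v β s true)) q₁)

towards : Vertex → Vertex → Vertex
towards v p = take (suc (length v)) p

towards-child : ∀ {v b p} → v ++ [ b ] ≼ p → towards v p ≡ v ++ [ b ]
towards-child {v} {b} q = subst (λ k → take k _ ≡ v ++ [ b ]) (length-child v b) (≼⇒take q)

module Realise {n : ℕ} (L : SortedLabelling n) where
  open SortedLabelling L
  open Reach {n}

  target : Config n
  target x = leaf (toℕ x)

  target-length : ∀ x → length (target x) ≡ n
  target-length x = leaf-length (toℕ<n x)

  target-injective : ∀ {x y} → target x ≡ target y → x ≡ y
  target-injective {x} {y} eq = toℕ-injective (begin
    toℕ x              ≡⟨ rank-leaf (toℕ<n x) ⟨
    rank (target x)    ≡⟨ cong rank eq ⟩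
    rank (target y)    ≡⟨ rank-leaf (toℕ<n y) ⟩
    toℕ y              ∎)
    where open ≡-Reasoning

  chipAt : ∀ p → length p ≡ n → Chip n
  chipAt p len = fromℕ< (rank< {p} len)

  target-chipAt : ∀ p len → target (chipAt p len) ≡ p
  target-chipAt p len = trans (cong leaf (toℕ-fromℕ< (rank< {p} len))) (leaf-rank len)

  override : ∀ {P : Pred (Chip n) 0ℓ} → Decidable P → Config n → Config n → Config n
  override P? d c x with P? x
  ... | yes _ = d x
  ... | no  _ = c x

  override-yes : ∀ {P : Pred (Chip n) 0ℓ} (P? : Decidable P) {d c x} → P x → override P? d c x ≡ d x
  override-yes P? {x = x} p with P? x
  ... | yes _ = refl
  ... | no ¬p = contradiction p ¬p

  override-no : ∀ {P : Pred (Chip n) 0ℓ} (P? : Decidable P) {d c x} → ¬ P x → override P? d c x ≡ c x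
  override-no P? {x = x} ¬p with P? x
  ... | yes p = contradiction p ¬p
  ... | no  _ = refl

  fire-pair : ∀ v s → length v + suc (length s) ≡ n → ∀ {c d : Config n} →
    (∀ x → Region v s (target x) → c x ≡ v × d x ≡ towards v (target x)) →
    (∀ x → ¬ Region v s (target x) → d x ≡ c x) → Fires {n} c d
  fire-pair v s len {c} {d} inside outside =
    fire v a b a<b (proj₁ (inside a (false , a-here))) (proj₁ (inside b (true , b-here)))
      (trans (proj₂ (inside a (false , a-here))) (towards-child (≼-trans (≼-++-child v false s) a-here)))
      (trans (proj₂ (inside b (true , b-here))) (towards-child (≼-trans (≼-++-child v true s) b-here)))
      λ x x≢a x≢b → outside x λ where
        (false , q) → x≢a (target-injective (trans (sym (leaf-eq false q)) (sym (target-chipAt _ (branch-length false)))))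
        (true  , q) → x≢b (target-injective (trans (sym (leaf-eq true q)) (sym (target-chipAt _ (branch-length true)))))
    where
    branch-length : ∀ β → length (v ++ β ∷ s) ≡ n
    branch-length β = trans (length-branch v β s) len
    a = chipAt (v ++ false ∷ s) (branch-length false)
    b = chipAt (v ++ true ∷ s) (branch-length true)
    a-here : v ++ false ∷ s ≼ target a
    a-here = subst (v ++ false ∷ s ≼_) (sym (target-chipAt _ (branch-length false))) ≼-refl
    b-here : v ++ true ∷ s ≼ target b
    b-here = subst (v ++ true ∷ s ≼_) (sym (target-chipAt _ (branch-length true))) ≼-refl
    a<b : toℕ a < toℕ b
    a<b = subst₂ _<_ (sym (toℕ-fromℕ< _)) (sym (toℕ-fromℕ< _)) (sorted v s len)
    leaf-eq : ∀ β {x} → v ++ β ∷ s ≼ target x → v ++ β ∷ s ≡ target x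
    leaf-eq β {x} q = ≼-antisym-length q (trans (branch-length β) (sym (target-length x)))

  fire-region : ∀ m v s → length v + suc (length s + m) ≡ n → ∀ {c d : Config n} →
    (∀ x → Region v s (target x) → c x ≡ v × d x ≡ towards v (target x)) →
    (∀ x → ¬ Region v s (target x) → d x ≡ c x) → c ↠ d
  fire-region zero v s len inside outside =
    ↠-fire (fire-pair v s (trans (cong (λ k → length v + suc k) (sym (+-identityʳ _))) len) inside outside)
  fire-region (suc m) v s len {c} {d} inside outside =
    ↠-trans (fire-region m v (s ++ [ false ]) (len′ false) inside₀ outside₀)
            (fire-region m v (s ++ [ true ]) (len′ true) inside₁ outside₁)
    where
    left? = λ x → region? v (s ++ [ false ]) (target x)
    after-left = override left? d c
    len′ : ∀ b → length v + suc (length (s ++ [ b ]) + m) ≡ n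
    len′ b = trans (cong (λ k → length v + suc (k + m)) (length-child s b))
                   (trans (cong (λ k → length v + suc k) (sym (+-suc (length s) m))) len)
    shorter : ∀ x → length v + suc (length s) < length (target x)
    shorter x = subst (length v + suc (length s) <_) (trans len (sym (target-length x)))
      (+-monoʳ-< (length v) (s≤s (≤-trans (s≤s (m≤m+n (length s) m)) (≤-reflexive (sym (+-suc (length s) m))))))
    inside₀ : ∀ x → Region v (s ++ [ false ]) (target x) → c x ≡ v × after-left x ≡ towards v (target x)
    inside₀ x r = proj₁ (inside x (region-shrink r)) , trans (override-yes left? r) (proj₂ (inside x (region-shrink r)))
    outside₀ : ∀ x → ¬ Region v (s ++ [ false ]) (target x) → after-left x ≡ c x
    outside₀ x ¬r = override-no left? ¬r
    inside₁ : ∀ x → Region v (s ++ [ true ]) (target x) → after-left x ≡ v × d x ≡ towards v (target x)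
    inside₁ x r = trans (override-no left? (λ r₀ → region-disjoint r₀ r)) (proj₁ (inside x (region-shrink r))) ,
                  proj₂ (inside x (region-shrink r))
    outside₁ : ∀ x → ¬ Region v (s ++ [ true ]) (target x) → d x ≡ after-left x
    outside₁ x ¬r₁ with left? x
    ... | yes _  = refl
    ... | no ¬r₀ = outside x λ r → [ ¬r₀ , ¬r₁ ]′ (region-split r (shorter x))

  below⇒region : ∀ {v} x → length v < n → v ≼ target x → Region v [] (target x)
  below⇒region x |v|<n q with ≼-self-or-child q
  ... | inj₁ refl      = contradiction (target-length x) (<⇒≢ |v|<n)
  ... | inj₂ (inj₁ q₀) = false , q₀
  ... | inj₂ (inj₂ q₁) = true , q₁

  fire-subtree : ∀ k v → length v + k ≡ n → ∀ {c d : Config n} →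
    (∀ x → v ≼ target x → c x ≡ v × d x ≡ target x) →
    (∀ x → ¬ v ≼ target x → d x ≡ c x) → c ↠ d
  fire-subtree zero v len {c} {d} inside outside = ↠-refl c≗d
    where
    c≗d : ∀ x → c x ≡ d x
    c≗d x with v ≼? target x
    ... | yes q = trans (proj₁ (inside x q))
                        (trans (≼-antisym-length q (trans (trans (sym (+-identityʳ _)) len) (sym (target-length x))))
                               (sym (proj₂ (inside x q))))
    ... | no ¬q = sym (outside x ¬q)
  fire-subtree (suc k) v len {c} {d} inside outside =
    ↠-trans (fire-region k v [] len inside₁ outside₁)
      (↠-trans (fire-subtree k (v ++ [ false ]) (len′ false) inside₂ outside₂)
               (fire-subtree k (v ++ [ true ]) (len′ true) inside₃ outside₃))
    where
    below? = λ x → v ≼? target x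
    left? = λ x → v ++ [ false ] ≼? target x
    after-v = override below? (λ x → towards v (target x)) c
    after-left = override left? target after-v
    |v|<n : length v < n
    |v|<n = <-≤-trans (m<m+n (length v) (s≤s z≤n)) (≤-reflexive len)
    len′ : ∀ b → length (v ++ [ b ]) + k ≡ n
    len′ b = trans (cong (_+ k) (length-child v b)) (trans (sym (+-suc (length v) k)) len)
    inside₁ : ∀ x → Region v [] (target x) → c x ≡ v × after-v x ≡ towards v (target x)
    inside₁ x r = proj₁ (inside x (child-≼ (proj₂ (region-child r)))) , override-yes below? (child-≼ (proj₂ (region-child r)))
    outside₁ : ∀ x → ¬ Region v [] (target x) → after-v x ≡ c x
    outside₁ x ¬r = override-no below? (¬r ∘ below⇒region x |v|<n)
    inside₂ : ∀ x → v ++ [ false ] ≼ target x → after-v x ≡ v ++ [ false ] × after-left x ≡ target x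
    inside₂ x q = trans (override-yes below? (child-≼ q)) (towards-child q) , override-yes left? q
    outside₂ : ∀ x → ¬ v ++ [ false ] ≼ target x → after-left x ≡ after-v x
    outside₂ x ¬q = override-no left? ¬q
    inside₃ : ∀ x → v ++ [ true ] ≼ target x → after-left x ≡ v ++ [ true ] × d x ≡ target x
    inside₃ x q = trans (override-no left? (λ q₀ → children-disjoint q₀ q)) (trans (override-yes below? (child-≼ q)) (towards-child q)) ,
                  proj₂ (inside x (child-≼ q))
    outside₃ : ∀ x → ¬ v ++ [ true ] ≼ target x → d x ≡ after-left x
    outside₃ x ¬q₁ with left? x
    ... | yes q₀ = proj₂ (inside x (child-≼ q₀))
    ... | no ¬q₀ with below? x
    ...   | no ¬q = outside x ¬q
    ...   | yes q with below⇒region x |v|<n q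
    ...     | false , q₀ = contradiction q₀ ¬q₀
    ...     | true  , q₁ = contradiction q₁ ¬q₁

  realise : initial n ↠ target
  realise = fire-subtree n [] refl (λ _ _ → refl , refl) (λ _ ¬q → contradiction ≼-root ¬q)

  lands-at-target : ∀ x → CanLand n x (index (target x))
  lands-at-target x with realise
  ... | c , steps , c≗target =
    c , steps , (λ a b eq → target-injective (trans (sym (c≗target a)) (trans eq (c≗target b)))) ,
    trans (cong length (c≗target x)) (target-length x) , cong index (c≗target x)

-- Where chips can land

valueLabelling : ∀ n → SortedLabelling n
valueLabelling n = record
  { rank        = value
  ; leaf        = bits n
  ; leaf-length = λ {k} _ → length-bits n k
  ; rank-leaf   = λ {k} → value-bits n k
  ; leaf-rank   = λ {p} len → subst (λ m → bits m (value p) ≡ p) len (bits-value p)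
  ; rank<       = λ {p} len → subst (λ m → value p < 2 ^ m) len (value< p)
  ; sorted      = λ v s _ → value-sorted v s
  }

reverse-branch : ∀ v (b : Bool) s → reverse (v ++ b ∷ s) ≡ reverse s ++ b ∷ reverse v
reverse-branch v b s = begin
  reverse (v ++ b ∷ s)             ≡⟨ reverse-++ v (b ∷ s) ⟩
  reverse (b ∷ s) ++ reverse v     ≡⟨ cong (_++ reverse v) (unfold-reverse b s) ⟩
  (reverse s ++ [ b ]) ++ reverse v ≡⟨ ++-assoc (reverse s) [ b ] (reverse v) ⟩
  reverse s ++ b ∷ reverse v       ∎
  where open ≡-Reasoning

reversedLabelling : ∀ n → SortedLabelling n
reversedLabelling n = record
  { rank        = value ∘ reverse
  ; leaf        = reverse ∘ bits n
  ; leaf-length = λ {k} _ → trans (length-reverse (bits n k)) (length-bits n k)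
  ; rank-leaf   = λ {k} k< → trans (cong value (reverse-involutive (bits n k))) (value-bits n k k<)
  ; leaf-rank   = λ {p} len → trans (cong reverse (subst (λ m → bits m (value (reverse p)) ≡ reverse p)
                                                          (trans (length-reverse p) len) (bits-value (reverse p))))
                                   (reverse-involutive p)
  ; rank<       = λ {p} len → subst (λ m → value (reverse p) < 2 ^ m) (trans (length-reverse p) len) (value< (reverse p))
  ; sorted      = λ v s _ → subst₂ _<_ (cong value (sym (reverse-branch v false s))) (cong value (sym (reverse-branch v true s)))
                                       (value-sorted (reverse s) (reverse v))
  }

module Rotation {r τ : ℕ} (r≤τ : r ≤ τ) where

  rotate : ℕ → ℕ
  rotate k with k ≟ τ | k <? r | k <? τ
  ... | yes _ | _     | _     = r
  ... | no _  | yes _ | _     = k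
  ... | no _  | no _  | yes _ = suc k
  ... | no _  | no _  | no _  = k

  unrotate : ℕ → ℕ
  unrotate l with l ≟ r | l <? r | l ≤? τ
  ... | yes _ | _     | _     = τ
  ... | no _  | yes _ | _     = l
  ... | no _  | no _  | yes _ = pred l
  ... | no _  | no _  | no _  = l

  rotate-τ : rotate τ ≡ r
  rotate-τ with τ ≟ τ
  ... | yes _   = refl
  ... | no  τ≢τ = contradiction refl τ≢τ

  rotate-below : ∀ {k} → k < r → rotate k ≡ k
  rotate-below {k} k<r with k ≟ τ | k <? r
  ... | yes k≡τ | _       = contradiction k≡τ (<⇒≢ (<-≤-trans k<r r≤τ))
  ... | no _    | yes _   = refl
  ... | no _    | no  k≮r = contradiction k<r k≮r

  rotate-middle : ∀ {k} → r ≤ k → k < τ → rotate k ≡ suc k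
  rotate-middle {k} r≤k k<τ with k ≟ τ | k <? r | k <? τ
  ... | yes k≡τ | _       | _       = contradiction k≡τ (<⇒≢ k<τ)
  ... | no _    | yes k<r | _       = contradiction r≤k (<⇒≱ k<r)
  ... | no _    | no _    | yes _   = refl
  ... | no _    | no _    | no  k≮τ = contradiction k<τ k≮τ

  rotate-above : ∀ {k} → τ < k → rotate k ≡ k
  rotate-above {k} τ<k with k ≟ τ | k <? r | k <? τ
  ... | yes k≡τ | _       | _     = contradiction (sym k≡τ) (<⇒≢ τ<k)
  ... | no _    | yes _   | _     = refl
  ... | no _    | no _    | yes k<τ = contradiction k<τ (<-asym τ<k)
  ... | no _    | no _    | no _  = refl

  unrotate-r : unrotate r ≡ τ
  unrotate-r with r ≟ r
  ... | yes _   = refl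
  ... | no  r≢r = contradiction refl r≢r

  unrotate-below : ∀ {l} → l < r → unrotate l ≡ l
  unrotate-below {l} l<r with l ≟ r | l <? r
  ... | yes l≡r | _       = contradiction l≡r (<⇒≢ l<r)
  ... | no _    | yes _   = refl
  ... | no _    | no  l≮r = contradiction l<r l≮r

  unrotate-middle : ∀ {l} → r < l → l ≤ τ → unrotate l ≡ pred l
  unrotate-middle {l} r<l l≤τ with l ≟ r | l <? r | l ≤? τ
  ... | yes l≡r | _       | _       = contradiction (sym l≡r) (<⇒≢ r<l)
  ... | no _    | yes l<r | _       = contradiction l<r (<-asym r<l)
  ... | no _    | no _    | yes _   = refl
  ... | no _    | no _    | no  l≰τ = contradiction l≤τ l≰τ

  unrotate-above : ∀ {l} → τ < l → unrotate l ≡ l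
  unrotate-above {l} τ<l with l ≟ r | l <? r | l ≤? τ
  ... | yes l≡r | _       | _       = contradiction (sym l≡r) (<⇒≢ (≤-<-trans r≤τ τ<l))
  ... | no _    | yes _   | _       = refl
  ... | no _    | no _    | yes l≤τ = contradiction l≤τ (<⇒≱ τ<l)
  ... | no _    | no _    | no _    = refl

  data Position (k : ℕ) : Set where
    at-τ   : k ≡ τ → Position k
    below  : k < r → Position k
    middle : r ≤ k → k < τ → Position k
    above  : τ < k → Position k

  position : ∀ k → Position k
  position k with <-cmp k τ
  ... | tri≈ _ k≡τ _ = at-τ k≡τ
  ... | tri> _ _ τ<k = above τ<k
  ... | tri< k<τ _ _ with k <? r
  ...   | yes k<r = below k<r
  ...   | no  k≮r = middle (≮⇒≥ k≮r) k<τ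

  unrotate-rotate : ∀ k → unrotate (rotate k) ≡ k
  unrotate-rotate k with position k
  ... | at-τ refl     = trans (cong unrotate rotate-τ) unrotate-r
  ... | below k<r     = trans (cong unrotate (rotate-below k<r)) (unrotate-below k<r)
  ... | middle r≤k k<τ = trans (cong unrotate (rotate-middle r≤k k<τ)) (unrotate-middle (s≤s r≤k) k<τ)
  ... | above τ<k     = trans (cong unrotate (rotate-above τ<k)) (unrotate-above τ<k)

  rotate-unrotate : ∀ l → rotate (unrotate l) ≡ l
  rotate-unrotate l with <-cmp l r
  ... | tri≈ _ refl _ = trans (cong rotate unrotate-r) rotate-τ
  ... | tri< l<r _ _  = trans (cong rotate (unrotate-below l<r)) (rotate-below l<r)
  ... | tri> _ _ r<l with τ <? l
  ...   | yes τ<l = trans (cong rotate (unrotate-above τ<l)) (rotate-above τ<l)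
  ...   | no  τ≮l = trans (cong rotate (unrotate-middle r<l (≮⇒≥ τ≮l))) (middle-pred r<l (≮⇒≥ τ≮l))
    where
    middle-pred : ∀ {l} → r < l → l ≤ τ → rotate (pred l) ≡ l
    middle-pred {suc l} (s≤s r≤l) l<τ = rotate-middle r≤l l<τ

  rotate-< : ∀ {N k} → τ < N → k < N → rotate k < N
  rotate-< {N} {k} τ<N k<N with position k
  ... | at-τ refl      = ≤-<-trans (≤-reflexive rotate-τ) (≤-<-trans r≤τ τ<N)
  ... | below k<r      = subst (_< N) (sym (rotate-below k<r)) k<N
  ... | middle r≤k k<τ = subst (_< N) (sym (rotate-middle r≤k k<τ)) (≤-<-trans k<τ τ<N)
  ... | above τ<k      = subst (_< N) (sym (rotate-above τ<k)) k<N

  unrotate-< : ∀ {N l} → τ < N → l < N → unrotate l < N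
  unrotate-< {N} {l} τ<N l<N with <-cmp l r
  ... | tri≈ _ refl _ = subst (_< N) (sym unrotate-r) τ<N
  ... | tri< l<r _ _  = subst (_< N) (sym (unrotate-below l<r)) l<N
  ... | tri> _ _ r<l with τ <? l
  ...   | yes τ<l = subst (_< N) (sym (unrotate-above τ<l)) l<N
  ...   | no  τ≮l = subst (_< N) (sym (unrotate-middle r<l (≮⇒≥ τ≮l))) (≤-<-trans pred[n]≤n l<N)

  rotate-sorted : ∀ {a b} → a < b → (b ≡ τ → a < r) → rotate a < rotate b
  rotate-sorted {a} {b} a<b b≡τ⇒a<r with position a | position b
  ... | _ | at-τ refl = subst₂ _<_ (sym (rotate-below (b≡τ⇒a<r refl))) (sym rotate-τ) (b≡τ⇒a<r refl)
  ... | at-τ refl | _ = subst₂ _<_ (sym rotate-τ) (sym (rotate-above a<b)) (≤-<-trans r≤τ a<b)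
  ... | below a<r | below b<r = subst₂ _<_ (sym (rotate-below a<r)) (sym (rotate-below b<r)) a<b
  ... | below a<r | middle r≤b b<τ = subst₂ _<_ (sym (rotate-below a<r)) (sym (rotate-middle r≤b b<τ)) (<-trans a<b (n<1+n b))
  ... | below a<r | above τ<b = subst₂ _<_ (sym (rotate-below a<r)) (sym (rotate-above τ<b)) a<b
  ... | middle r≤a a<τ | below b<r = contradiction (<-trans a<b b<r) (≤⇒≯ r≤a)
  ... | middle r≤a a<τ | middle r≤b b<τ = subst₂ _<_ (sym (rotate-middle r≤a a<τ)) (sym (rotate-middle r≤b b<τ)) (s≤s a<b)
  ... | middle r≤a a<τ | above τ<b = subst₂ _<_ (sym (rotate-middle r≤a a<τ)) (sym (rotate-above τ<b)) (≤-<-trans a<τ τ<b)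
  ... | above τ<a | below b<r = contradiction (<-trans (<-trans τ<a a<b) b<r) (≤⇒≯ r≤τ)
  ... | above τ<a | middle _ b<τ = contradiction (<-trans τ<a a<b) (<-asym b<τ)
  ... | above τ<a | above τ<b = subst₂ _<_ (sym (rotate-above τ<a)) (sym (rotate-above τ<b)) a<b

-- The rivals of t are the leaves v0s with v1s = t; their chips are fired together with the one bound for t.
module Insertion {n} (L : SortedLabelling n) (t : Vertex) (t-leaf : length t ≡ n) (r : ℕ)
  (r≤τ : r ≤ SortedLabelling.rank L t)
  (rivals<r : ∀ v s → v ++ true ∷ s ≡ t → SortedLabelling.rank L (v ++ false ∷ s) < r) where
  open SortedLabelling L
  open Rotation r≤τ

  private
    τ<2^n : rank t < 2 ^ n
    τ<2^n = rank< t-leaf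

    rank≡τ⇒t : ∀ {p} → length p ≡ n → rank p ≡ rank t → p ≡ t
    rank≡τ⇒t {p} len eq = trans (sym (leaf-rank len)) (trans (cong leaf eq) (leaf-rank t-leaf))

  labelling : SortedLabelling n
  labelling = record
    { rank        = rotate ∘ rank
    ; leaf        = leaf ∘ unrotate
    ; leaf-length = λ k< → leaf-length (unrotate-< τ<2^n k<)
    ; rank-leaf   = λ {k} k< → trans (cong rotate (rank-leaf (unrotate-< τ<2^n k<))) (rotate-unrotate k)
    ; leaf-rank   = λ {p} len → trans (cong leaf (unrotate-rotate (rank p))) (leaf-rank len)
    ; rank<       = λ len → rotate-< τ<2^n (rank< len)
    ; sorted      = λ v s len → rotate-sorted (sorted v s len) (rivals<r v s ∘ rank≡τ⇒t (trans (length-++ v) len))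
    }

  r-placed-on-t : SortedLabelling.leaf labelling r ≡ t
  r-placed-on-t = trans (cong leaf unrotate-r) (leaf-rank t-leaf)

can-land-at : ∀ {n} (L : SortedLabelling n) {t} → length t ≡ n → ∀ x →
  toℕ x ≤ SortedLabelling.rank L t →
  (∀ v s → v ++ true ∷ s ≡ t → SortedLabelling.rank L (v ++ false ∷ s) < toℕ x) →
  CanLand n x (index t)
can-land-at {n} L {t} t-leaf x x≤τ rivals<x =
  subst (CanLand n x) (cong index r-placed-on-t) (Realise.lands-at-target labelling x)
  where open Insertion L t t-leaf (toℕ x) x≤τ rivals<x

lands-somewhere : ∀ {n} (x : Chip n) → Σ ℕ (CanLand n x)
lands-somewhere {n} x = _ , Realise.lands-at-target (valueLabelling n) x

-- In the bit-reversed numbering the second leaf carries the number 2^m and its only rival, the leftmost leaf, carries 0.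
lands-second : ∀ m (x : Chip (suc m)) → 1 ≤ toℕ x → toℕ x ≤ 2 ^ m → CanLand (suc m) x 2
lands-second m x 1≤x x≤2^m = subst (CanLand (suc m) x) (cong suc (value-second-leaf m))
  (can-land-at (reversedLabelling (suc m)) (length-replicate-∷ʳ m true) x (subst (toℕ x ≤_) (sym rank-t) x≤2^m) rivals<x)
  where
  t = replicate m false ++ [ true ]
  rank-t : value (reverse t) ≡ 2 ^ m
  rank-t = trans (cong value (trans (reverse-++ (replicate m false) [ true ]) (cong (true ∷_) (reverse-replicate m false)))) (value-first-right m)
  rivals<x : ∀ v s → v ++ true ∷ s ≡ t → value (reverse (v ++ false ∷ s)) < toℕ x
  rivals<x v s eq with branch-of-second-leaf v s m eq
  ... | refl , refl = subst (_< toℕ x) (sym rank-leftmost) 1≤x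
    where
    rank-leftmost : value (reverse (replicate m false ++ [ false ])) ≡ 0
    rank-leftmost = trans (cong (value ∘ reverse) (replicate-snoc m false))
                          (trans (cong value (reverse-replicate (suc m) false)) (value-leftmost (suc m)))

lands-middle : ∀ m (x : Chip (suc m)) → 1 ≤ toℕ x → toℕ x ≤ 2 ^ m → CanLand (suc m) x (suc (2 ^ m))
lands-middle m x 1≤x x≤2^m = subst (CanLand (suc m) x) (cong suc (value-first-right m))
  (can-land-at (valueLabelling (suc m)) (cong suc (length-replicate m)) x (subst (toℕ x ≤_) (sym (value-first-right m)) x≤2^m) rivals<x)
  where
  rivals<x : ∀ v s → v ++ true ∷ s ≡ true ∷ replicate m false → value (v ++ false ∷ s) < toℕ x
  rivals<x []      _ refl = subst (_< toℕ x) (sym (value-leftmost (suc m))) 1≤x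
  rivals<x (_ ∷ v) s eq   = contradiction (∷-injectiveʳ eq) (branch≢leftmost v s m)

-- The number 2 is first rotated onto 10…0, so that the rivals 00…01 and 10…0 of the target 10…01 carry the numbers 1 and 2.
lands-after-middle : ∀ m (x : Chip (suc (suc m))) → 3 ≤ toℕ x → toℕ x ≤ 2 ^ suc m + 1 →
                     CanLand (suc (suc m)) x (2 ^ suc m + 2)
lands-after-middle m x 3≤x x≤M+1 = subst (CanLand (suc (suc m)) x) (trans (cong suc value-t₂) (sym (+-suc M 1)))
  (can-land-at L₁ (cong suc (length-replicate-∷ʳ m true)) x (subst (toℕ x ≤_) (sym rank-t₂) x≤M+1) rivals<x)
  where
  M = 2 ^ suc m
  t₁ = true ∷ replicate (suc m) false
  t₂ = true ∷ (replicate m false ++ [ true ])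
  2≤M : 2 ≤ value t₁
  2≤M = subst (2 ≤_) (sym (value-first-right (suc m))) (^-monoʳ-≤ 2 {1} {suc m} (s≤s z≤n))
  rivals<2 : ∀ v s → v ++ true ∷ s ≡ t₁ → value (v ++ false ∷ s) < 2
  rivals<2 []      _ refl = subst (_< 2) (sym (value-leftmost (suc (suc m)))) (s≤s z≤n)
  rivals<2 (_ ∷ v) s eq   = contradiction (∷-injectiveʳ eq) (branch≢leftmost v s (suc m))
  L₁ = Insertion.labelling (valueLabelling (suc (suc m))) t₁ (cong suc (length-replicate (suc m))) 2 2≤M rivals<2
  open Rotation 2≤M
  value-t₂ : value t₂ ≡ M + 1
  value-t₂ = trans (value-true∷ (replicate m false ++ [ true ])) (cong₂ _+_ (cong (2 ^_) (length-replicate-∷ʳ m true)) (value-second-leaf m))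
  rank-t₂ : rotate (value t₂) ≡ M + 1
  rank-t₂ = trans (rotate-above (subst₂ _<_ (sym (value-first-right (suc m))) (sym value-t₂) (m<m+n M (s≤s z≤n)))) value-t₂
  rivals<x : ∀ v s → v ++ true ∷ s ≡ t₂ → rotate (value (v ++ false ∷ s)) < toℕ x
  rivals<x [] _ refl = subst (_< toℕ x) (sym rank-00…01) (≤-trans (s≤s (s≤s z≤n)) 3≤x)
    where
    rank-00…01 : rotate (value (false ∷ replicate m false ++ [ true ])) ≡ 1
    rank-00…01 = trans (cong rotate (trans (value-∷ false (replicate m false ++ [ true ])) (value-second-leaf m)))
                       (rotate-below (s≤s (s≤s z≤n)))
  rivals<x (true ∷ v) s eq with branch-of-second-leaf v s m (∷-injectiveʳ eq)
  ... | refl , refl = subst (_< toℕ x) (sym (trans (cong (rotate ∘ value ∘ (true ∷_)) (replicate-snoc m false)) rotate-τ)) 3≤x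

<∧1+≢⇒+2≤ : ∀ {r M} → r < M → suc r ≢ M → r + 2 ≤ M
<∧1+≢⇒+2≤ {r} {M} r<M 1+r≢M = subst (_≤ M) (+-comm 2 r) (≤∧≢⇒< r<M 1+r≢M)

3≤-unless-small : ∀ {r} → r ≢ 0 → r ≢ 1 → r ≢ 2 → 3 ≤ r
3≤-unless-small {0}                 ≢0 _  _  = contradiction refl ≢0
3≤-unless-small {1}                 _  ≢1 _  = contradiction refl ≢1
3≤-unless-small {2}                 _  _  ≢2 = contradiction refl ≢2
3≤-unless-small {suc (suc (suc _))} _  _  _  = s≤s (s≤s (s≤s z≤n))

spread-≥ : ∀ {n x s i j} → Spread n x s → CanLand n x i → CanLand n x j → j ∸ i + 1 ≤ s
spread-≥ (lo , hi , _ , _ , bounds , refl) land-i land-j =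
  +-monoˡ-≤ 1 (∸-mono (proj₂ (bounds _ land-j)) (proj₁ (bounds _ land-i)))

spread-≤ : ∀ {n x s lo hi} → Spread n x s → (∀ i → CanLand n x i → lo ≤ i × i ≤ hi) → s ≤ hi ∸ lo + 1
spread-≤ (_ , _ , land-lo , land-hi , _ , refl) bounds =
  +-monoˡ-≤ 1 (∸-mono (proj₂ (bounds _ land-hi)) (proj₁ (bounds _ land-lo)))

spread-exact : ∀ {n x lo hi} → CanLand n x lo → CanLand n x hi →
               (∀ i → CanLand n x i → lo ≤ i × i ≤ hi) → Spread n x (hi ∸ lo + 1)
spread-exact land-lo land-hi bounds = _ , _ , land-lo , land-hi , bounds , refl

first-chip-spread : ∀ {n} (x : Chip n) → toℕ x ≡ 0 → Spread n x 1
first-chip-spread {n} x x≡0 with lands-somewhere {n} x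
... | i , land with chip-zero-lands-first {n} x≡0 land
... | refl = spread-exact land land λ j land-j →
  ≤-reflexive (sym (chip-zero-lands-first x≡0 land-j)) , ≤-reflexive (chip-zero-lands-first x≡0 land-j)

first-chip-spread-≤ : ∀ {n x s} → toℕ x ≡ 0 → Spread n x s → s ≤ 1
first-chip-spread-≤ x≡0 sp = spread-≤ sp λ j land-j →
  ≤-reflexive (sym (chip-zero-lands-first x≡0 land-j)) , ≤-reflexive (chip-zero-lands-first x≡0 land-j)

-- For a chip x, toℕ x is its label minus one and x̄ = opposite x is its mirror image: toℕ x̄ + toℕ x + 1 = 2^n.
module Spreads (k : ℕ) where
  n = suc (suc k)
  M = 2 ^ suc k
  N = 2 ^ n

  N≡M+M : N ≡ M + M
  N≡M+M = cong (M +_) (+-identityʳ M)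

  2≤M : 2 ≤ M
  2≤M = ^-monoʳ-≤ 2 {1} {suc k} (s≤s z≤n)

  4≤N : 4 ≤ N
  4≤N = subst (4 ≤_) (sym N≡M+M) (+-mono-≤ 2≤M 2≤M)

  opposite-sum : ∀ (x : Chip n) → toℕ (opposite x) + suc (toℕ x) ≡ M + M
  opposite-sum x = trans (cong (_+ suc (toℕ x)) (opposite-prop x)) (trans (m∸n+n≡m (toℕ<n x)) N≡M+M)

  lands-last-but-one⇒≤ : ∀ {x : Chip n} → CanLand n x (N ∸ 1) → toℕ (opposite x) ≤ M
  lands-last-but-one⇒≤ land = lands-second⇒≤ (subst (CanLand n _) (suc-N∸[N∸1] 4≤N) (CanLand-mirror land))
    where
    suc-N∸[N∸1] : ∀ {N} → 4 ≤ N → suc N ∸ (N ∸ 1) ≡ 2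
    suc-N∸[N∸1] {suc N} _ = m+n∸n≡m 2 N

  lands-before-last : ∀ {x : Chip n} {i} → toℕ (opposite x) ≢ 0 → CanLand n x i → i ≤ N ∸ 1
  lands-before-last x̄≢0 land = <⇒≤∸1 (2≤suc-N∸i⇒i<N (other-chips-land-after-first x̄≢0 (CanLand-mirror land)))
    where
    2≤suc-N∸i⇒i<N : ∀ {N i} → 2 ≤ suc N ∸ i → i < N
    2≤suc-N∸i⇒i<N {N}     {zero}  le = ≤-pred le
    2≤suc-N∸i⇒i<N {suc N} {suc i} le = s≤s (2≤suc-N∸i⇒i<N le)
    2≤suc-N∸i⇒i<N {zero}  {suc i} le = contradiction (≤-trans le (≤-reflexive (0∸n≡0 i))) λ ()
    <⇒≤∸1 : ∀ {i N} → i < N → i ≤ N ∸ 1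
    <⇒≤∸1 {N = suc N} (s≤s i≤N) = i≤N

  N∸1∸2+1≡N∸2 : N ∸ 1 ∸ 2 + 1 ≡ N ∸ 2
  N∸1∸2+1≡N∸2 = go 4≤N
    where
    go : ∀ {N} → 4 ≤ N → N ∸ 1 ∸ 2 + 1 ≡ N ∸ 2
    go {suc (suc (suc N))} (s≤s (s≤s (s≤s _))) = +-comm N 1

  N∸2∸2+1<N∸2 : N ∸ 2 ∸ 2 + 1 < N ∸ 2
  N∸2∸2+1<N∸2 = go 4≤N
    where
    go : ∀ {N} → 4 ≤ N → N ∸ 2 ∸ 2 + 1 < N ∸ 2
    go {suc (suc (suc (suc N)))} (s≤s (s≤s (s≤s (s≤s _)))) = ≤-reflexive (cong suc (+-comm N 1))

  1<N∸2 : 1 < N ∸ 2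
  1<N∸2 = go 4≤N
    where
    go : ∀ {N} → 4 ≤ N → 1 < N ∸ 2
    go (s≤s (s≤s (s≤s (s≤s _)))) = s≤s (s≤s z≤n)

  1≤M : 1 ≤ M
  1≤M = ≤-trans (s≤s z≤n) 2≤M

  small-chip-spread : ∀ (x : Chip n) → toℕ x ≡ 1 ⊎ toℕ x ≡ 2 → Spread n x M
  small-chip-spread x x≡1∨2 = subst (Spread n x) (m∸n+n≡m 1≤M)
    (spread-exact (lands-second (suc k) x 1≤x x≤M) (lands-middle (suc k) x 1≤x x≤M)
      λ i land → other-chips-land-after-first (>⇒≢ 1≤x) land , small-chips-land-≤-middle (s≤s x≤2) land)
    where
    1≤x : 1 ≤ toℕ x
    1≤x = [ (λ e → ≤-reflexive (sym e)) , (λ e → subst (1 ≤_) (sym e) (s≤s z≤n)) ]′ x≡1∨2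
    x≤2 : toℕ x ≤ 2
    x≤2 = [ (λ e → subst (_≤ 2) (sym e) (s≤s z≤n)) , ≤-reflexive ]′ x≡1∨2
    x≤M = ≤-trans x≤2 2≤M

  left-chip-spread-≥ : ∀ {x s} → Spread n x s → 1 ≤ toℕ x → toℕ x ≤ M → M ≤ s
  left-chip-spread-≥ {x} {s} sp 1≤x x≤M = subst (_≤ s) (m∸n+n≡m 1≤M)
    (spread-≥ sp (lands-second (suc k) x 1≤x x≤M) (lands-middle (suc k) x 1≤x x≤M))

  left-chip-spread-> : ∀ {x s} → Spread n x s → 3 ≤ toℕ x → toℕ x ≤ M → M < s
  left-chip-spread-> {x} {s} sp 3≤x x≤M = subst (_≤ s) (trans (cong (_+ 1) (m+n∸n≡m M 2)) (+-comm M 1))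
    (spread-≥ sp (lands-second (suc k) x (≤-trans (s≤s z≤n) 3≤x) x≤M) (lands-after-middle k x 3≤x (≤-trans x≤M (m≤m+n M 1))))

  central-chip-spread : ∀ (x : Chip n) → 1 ≤ toℕ x → toℕ x ≤ M → 1 ≤ toℕ (opposite x) → toℕ (opposite x) ≤ M →
                       Spread n x (N ∸ 2)
  central-chip-spread x 1≤x x≤M 1≤x̄ x̄≤M = subst (Spread n x) N∸1∸2+1≡N∸2
    (spread-exact (lands-second (suc k) x 1≤x x≤M) (CanLand-mirror⁻ (lands-second (suc k) (opposite x) 1≤x̄ x̄≤M))
      λ i land → other-chips-land-after-first (>⇒≢ 1≤x) land , lands-before-last (>⇒≢ 1≤x̄) land)

  spread-≤-N∸2 : ∀ (x : Chip n) s → Spread n x s → s ≤ N ∸ 2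
  spread-≤-N∸2 x s sp with toℕ x ≟ 0 | toℕ (opposite x) ≟ 0
  ... | yes x≡0 | _       = ≤-trans (first-chip-spread-≤ x≡0 sp) (<⇒≤ 1<N∸2)
  ... | no _    | yes x̄≡0 = ≤-trans (first-chip-spread-≤ x̄≡0 (Spread-mirror sp)) (<⇒≤ 1<N∸2)
  ... | no x≢0  | no x̄≢0  = subst (s ≤_) N∸1∸2+1≡N∸2
    (spread-≤ sp λ i land → other-chips-land-after-first x≢0 land , lands-before-last x̄≢0 land)

  left-chip-spread-< : ∀ {x s} → Spread n x s → 1 ≤ toℕ x → toℕ x + 2 ≤ M → s < N ∸ 2
  left-chip-spread-< {x} {s} sp 1≤x x+2≤M = ≤-<-trans (spread-≤ sp bounds) N∸2∸2+1<N∸2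
    where
    x̄≰M : ¬ toℕ (opposite x) ≤ M
    x̄≰M x̄≤M = <-irrefl (opposite-sum x) (+-mono-≤-< x̄≤M (subst (_≤ M) (+-comm (toℕ x) 2) x+2≤M))
    below-last-but-one : ∀ {i} → i ≤ N ∸ 1 → i ≢ N ∸ 1 → i ≤ N ∸ 2
    below-last-but-one {i} i≤ i≢ = subst (i ≤_) (∸-+-assoc N 1 1) (<⇒≤∸1 (≤∧≢⇒< i≤ i≢))
      where
      <⇒≤∸1 : ∀ {i K} → i < K → i ≤ K ∸ 1
      <⇒≤∸1 {K = suc K} (s≤s i≤K) = i≤K
    bounds : ∀ i → CanLand n x i → 2 ≤ i × i ≤ N ∸ 2
    bounds i land = other-chips-land-after-first (>⇒≢ 1≤x) land ,
      below-last-but-one (lands-before-last (λ x̄≡0 → x̄≰M (subst (_≤ M) (sym x̄≡0) z≤n)) land)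
                         (λ i≡ → x̄≰M (lands-last-but-one⇒≤ (subst (CanLand n x) i≡ land)))

  opposite-label : ∀ (x : Chip n) → label n x ≡ N ∸ toℕ (opposite x)
  opposite-label x = trans (sym (m+n∸m≡n (toℕ (opposite x)) (suc (toℕ x))))
                           (cong (_∸ toℕ (opposite x)) (trans (opposite-sum x) (sym N≡M+M)))

  label≡N∸⇒ : ∀ (x : Chip n) {j} → j ≤ N → label n x ≡ N ∸ j → toℕ (opposite x) ≡ j
  label≡N∸⇒ x j≤N eq = trans (opposite-prop x) (trans (cong (N ∸_) eq) (m∸[m∸n]≡n j≤N))

  label≢N∸⇒ : ∀ (x : Chip n) {j} → label n x ≢ N ∸ j → toℕ (opposite x) ≢ j
  label≢N∸⇒ x ne x̄≡j = ne (trans (opposite-label x) (cong (N ∸_) x̄≡j))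

  left-or-mirrored : ∀ (x : Chip n) → toℕ x < M ⊎ toℕ (opposite x) < M
  left-or-mirrored x with toℕ x <? M
  ... | yes x<M = inj₁ x<M
  ... | no  x≮M = inj₂ (≰⇒> λ M≤x̄ → <-irrefl (sym (opposite-sum x)) (+-mono-≤-< M≤x̄ (s≤s (≮⇒≥ x≮M))))

  extreme-chip-spread : ∀ (x : Chip n) → label n x ≡ 1 ⊎ label n x ≡ N → Spread n x 1
  extreme-chip-spread x (inj₁ eq) = first-chip-spread x (suc-injective eq)
  extreme-chip-spread x (inj₂ eq) = Spread-opposite⁻ (first-chip-spread (opposite x) (label≡N∸⇒ x z≤n eq))

  near-extreme-chip-spread : ∀ (x : Chip n) →
    label n x ≡ 2 ⊎ label n x ≡ 3 ⊎ label n x ≡ N ∸ 2 ⊎ label n x ≡ N ∸ 1 → Spread n x M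
  near-extreme-chip-spread x (inj₁ eq)               = small-chip-spread x (inj₁ (suc-injective eq))
  near-extreme-chip-spread x (inj₂ (inj₁ eq))        = small-chip-spread x (inj₂ (suc-injective eq))
  near-extreme-chip-spread x (inj₂ (inj₂ (inj₁ eq))) =
    Spread-opposite⁻ (small-chip-spread (opposite x) (inj₂ (label≡N∸⇒ x (≤-trans (n≤1+n 2) (≤-trans (n≤1+n 3) 4≤N)) eq)))
  near-extreme-chip-spread x (inj₂ (inj₂ (inj₂ eq))) =
    Spread-opposite⁻ (small-chip-spread (opposite x) (inj₁ (label≡N∸⇒ x (≤-trans (s≤s z≤n) 4≤N) eq)))

  inner-chip-spread-≥ : ∀ (x : Chip n) s → Spread n x s → label n x ≢ 1 → label n x ≢ N → M ≤ s
  inner-chip-spread-≥ x s sp ≢1 ≢N with left-or-mirrored x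
  ... | inj₁ x<M = left-chip-spread-≥ sp (n≢0⇒n>0 (≢1 ∘ cong suc)) (<⇒≤ x<M)
  ... | inj₂ x̄<M = left-chip-spread-≥ (Spread-mirror sp) (n≢0⇒n>0 (label≢N∸⇒ x ≢N)) (<⇒≤ x̄<M)

  inner-chip-spread-> : ∀ (x : Chip n) s → Spread n x s → label n x ≢ 1 → label n x ≢ N →
    label n x ≢ 2 → label n x ≢ 3 → label n x ≢ N ∸ 2 → label n x ≢ N ∸ 1 → M < s
  inner-chip-spread-> x s sp ≢1 ≢N ≢2 ≢3 ≢N∸2 ≢N∸1 with left-or-mirrored x
  ... | inj₁ x<M = left-chip-spread-> sp (3≤-unless-small (≢1 ∘ cong suc) (≢2 ∘ cong suc) (≢3 ∘ cong suc)) (<⇒≤ x<M)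
  ... | inj₂ x̄<M = left-chip-spread-> (Spread-mirror sp)
                     (3≤-unless-small (label≢N∸⇒ x ≢N) (label≢N∸⇒ x ≢N∸1) (label≢N∸⇒ x ≢N∸2)) (<⇒≤ x̄<M)

  middle-chip-spread : ∀ (x : Chip n) → label n x ≡ M ⊎ label n x ≡ M + 1 → Spread n x (N ∸ 2)
  middle-chip-spread x middle = central-chip-spread x (≤-pred (≤-trans 2≤M M≤label)) (≤-pred label≤1+M) 1≤x̄ x̄≤M
    where
    M≤label : M ≤ label n x
    M≤label = [ (λ e → ≤-reflexive (sym e)) , (λ e → ≤-trans (m≤m+n M 1) (≤-reflexive (sym e))) ]′ middle
    label≤1+M : label n x ≤ suc M
    label≤1+M = [ (λ e → ≤-trans (≤-reflexive e) (n≤1+n M)) , (λ e → ≤-reflexive (trans e (+-comm M 1))) ]′ middle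
    x̄≤M : toℕ (opposite x) ≤ M
    x̄≤M = +-cancelʳ-≤ M _ M (≤-trans (+-monoʳ-≤ (toℕ (opposite x)) M≤label) (≤-reflexive (opposite-sum x)))
    1≤x̄ : 1 ≤ toℕ (opposite x)
    1≤x̄ = n≢0⇒n>0 λ x̄≡0 → <⇒≱ 2≤M (+-cancelˡ-≤ M M 1 (begin
      M + M       ≡⟨ opposite-sum x ⟨
      toℕ (opposite x) + label n x ≡⟨ cong (_+ label n x) x̄≡0 ⟩
      label n x   ≤⟨ label≤1+M ⟩
      suc M       ≡⟨ +-comm 1 M ⟩
      M + 1       ∎))
      where open ≤-Reasoning

  1+x̄≡M⇒label≡M+1 : ∀ (x : Chip n) → suc (toℕ (opposite x)) ≡ M → label n x ≡ M + 1
  1+x̄≡M⇒label≡M+1 x 1+x̄≡M = trans (cong suc (+-cancelˡ-≡ M (toℕ x) M (begin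
    M + toℕ x                        ≡⟨ cong (_+ toℕ x) 1+x̄≡M ⟨
    suc (toℕ (opposite x)) + toℕ x   ≡⟨ +-suc (toℕ (opposite x)) (toℕ x) ⟨
    toℕ (opposite x) + label n x     ≡⟨ opposite-sum x ⟩
    M + M                            ∎))) (+-comm 1 M)
    where open ≡-Reasoning

  non-middle-chip-spread-< : ∀ (x : Chip n) s → Spread n x s → label n x ≢ M → label n x ≢ M + 1 → s < N ∸ 2
  non-middle-chip-spread-< x s sp ≢M ≢M+1 with toℕ x ≟ 0 | toℕ (opposite x) ≟ 0
  ... | yes x≡0 | _       = ≤-<-trans (first-chip-spread-≤ x≡0 sp) 1<N∸2
  ... | no _    | yes x̄≡0 = ≤-<-trans (first-chip-spread-≤ x̄≡0 (Spread-mirror sp)) 1<N∸2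
  ... | no x≢0  | no x̄≢0 with left-or-mirrored x
  ...   | inj₁ x<M = left-chip-spread-< sp (n≢0⇒n>0 x≢0) (<∧1+≢⇒+2≤ x<M ≢M)
  ...   | inj₂ x̄<M = left-chip-spread-< (Spread-mirror sp) (n≢0⇒n>0 x̄≢0) (<∧1+≢⇒+2≤ x̄<M (≢M+1 ∘ 1+x̄≡M⇒label≡M+1 x))

theorem8p14 : (n : ℕ) → 1 < n →
  -- smallest spread 1, attained by chips 1 and 2^n
  ((c : Chip n) → (label n c ≡ 1 ⊎ label n c ≡ 2 ^ n) → Spread n c 1) ×
  -- second smallest spread 2^(n-1), attained by chips 2, 3, 2^n-2, 2^n-1
  ((c : Chip n) →
     (label n c ≡ 2 ⊎ label n c ≡ 3 ⊎ label n c ≡ 2 ^ n ∸ 2 ⊎ label n c ≡ 2 ^ n ∸ 1) →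
     Spread n c (2 ^ (n ∸ 1))) ×
  -- every other chip has spread at least 2^(n-1) (so > 1) ...
  ((c : Chip n) (s : ℕ) → Spread n c s →
     label n c ≢ 1 → label n c ≢ 2 ^ n → 2 ^ (n ∸ 1) ≤ s) ×
  -- ... and strictly more than 2^(n-1) unless it is one of 2, 3, 2^n-2, 2^n-1
  ((c : Chip n) (s : ℕ) → Spread n c s →
     label n c ≢ 1 → label n c ≢ 2 ^ n →
     label n c ≢ 2 → label n c ≢ 3 → label n c ≢ 2 ^ n ∸ 2 → label n c ≢ 2 ^ n ∸ 1 →
     2 ^ (n ∸ 1) < s) ×
  -- largest spread 2^n-2, attained by chips 2^(n-1) and 2^(n-1)+1
  ((c : Chip n) → (label n c ≡ 2 ^ (n ∸ 1) ⊎ label n c ≡ 2 ^ (n ∸ 1) + 1) →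
     Spread n c (2 ^ n ∸ 2)) ×
  ((c : Chip n) (s : ℕ) → Spread n c s → s ≤ 2 ^ n ∸ 2) ×
  ((c : Chip n) (s : ℕ) → Spread n c s →
     label n c ≢ 2 ^ (n ∸ 1) → label n c ≢ 2 ^ (n ∸ 1) + 1 → s < 2 ^ n ∸ 2)
theorem8p14 zero ()
theorem8p14 (suc zero) (s≤s ())
theorem8p14 (suc (suc k)) _ =
  extreme-chip-spread , near-extreme-chip-spread , inner-chip-spread-≥ , inner-chip-spread-> ,
  middle-chip-spread , spread-≤-N∸2 , non-middle-chip-spread-<
  where open Spreads k
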